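{- Let $R$ be an integral domain, $\alpha,\beta,\gamma,\delta\in R$, and let $f$ be a function from hypergraphs (with nonempty hyperedges) to $R$ that is invariant under hypergraph isomorphism and satisfies: $f(E_0)=1$; $f(E_1)=\alpha$; $f(H_1\sqcup H_2)=f(H_1)f(H_2)$ for all hypergraphs $H_1,H_2$; and $f(H)=\beta f(H-e)+\gamma f(H/e)+\delta f(H\dagger e)$ for every hypergraph $H$ and every edge $e$ of $H$. Then one of the following holds: (1) $\delta=0$ and $f(H)=\beta^{m(H)}\xi(H;\alpha,\gamma/\beta,0)$ for all $H$; (2) $\beta=1$ and $f(H)=\xi(H;\alpha,\gamma,\delta)$ for all $H$; (3) $f(H)=\alpha^{n(H)}=\xi(H;\alpha,0,0)$ for all $H$. Here $n(H)$ and $m(H)$ are the numbers of vertices and edges of $H$.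
   Context: A hypergraph $H=(V,E)$ has finite vertex set $V$ and finite indexed family $E=(e_i)_{i\in I}$ of subsets of $V$ (parallel edges allowed); here all hyperedges are nonempty. $E_0$ is the hypergraph with no vertices and no edges, $E_1$ the hypergraph with one vertex and no edges. For $J\subseteq I$, $H_J=(V,(e_j)_{j\in J})$ is the partial hypergraph and $H\times J$ the edge section hypergraph with vertex set $\bigcup_{j\in J}e_j$ and edges $(e_j)_{j\in J}$; $k(G)$ is the number of connected components of $G$ (a hypergraph without vertices has $0$). A pair $(A,B)$ of disjoint subsets of $I$ is vertex disjoint if $e_a\cap e_b=\emptyset$ for all $a\in A,b\in B$. The hyperedge elimination polynomial is $\xi(H;x,y,z)=\sum_{(A,B)}x^{k(H_{A\sqcup B})-k(H\times B)}y^{|A|+|B|-k(H\times B)}z^{k(H\times B)}$ over vertex disjoint pairs (evaluations in the fraction field of $R$, with $0^0=1$). For an edge $e_i$: deletion $H-e_i=(V,(e_j)_{j\neq i})$; extraction $H\dagger e_i=(V\setminus e_i,(e_j)_{j\neq i,\ e_j\cap e_i=\emptyset})$; contraction $H/e_i$ has vertex set $(V\setminus e_i)\cup\{v_i\}$ with $v_i$ new and edges indexed by $j\neq i$, equal to $e_j$ if $e_j\cap e_i=\emptyset$ and to $(e_j\setminus e_i)\cup\{v_i\}$ otherwise. -}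

module Defs where

open import Level using (Level; _⊔_) renaming (suc to lsuc)
open import Data.Nat.Base using (ℕ; zero; suc; _∸_; _<ᵇ_) renaming (_+_ to _+ℕ_)
open import Data.Fin.Base using (Fin; zero; suc; toℕ; splitAt)
open import Data.Fin.Properties using (_≟_)
open import Data.Bool.Base using (Bool; true; false; not; _∧_; _∨_; if_then_else_)
open import Data.List.Base using (List; []; _∷_; [_]; length; lookup; allFin; filterᵇ; map; concatMap; foldr)
open import Data.Bool.ListAction using (any; all)
open import Data.Sum.Base using (_⊎_; inj₁; inj₂; [_,_])
open import Data.Product.Base using (∃; _×_)
open import Function.Base using (const)
open import Function.Bundles using (_↔_; Inverse)
open import Relation.Nullary.Decidable using (⌊_⌋)
open import Relation.Nullary.Negation using (¬_)
open import Relation.Binary.PropositionalEquality using (_≡_)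
open import Algebra.Bundles using (CommutativeRing)

-- Hypergraphs: vertex set Fin n, edges indexed by Fin m, edge i given by
-- its incidence (characteristic) function  inc i : Fin n → Bool.

record Hypergraph : Set where
  constructor hg
  field
    n   : ℕ
    m   : ℕ
    inc : Fin m → Fin n → Bool

open Hypergraph public

NonEmptyEdges : Hypergraph → Set
NonEmptyEdges H = ∀ (i : Fin (m H)) → ∃ λ v → inc H i v ≡ true

record _≅_ (H H' : Hypergraph) : Set where
  field
    vbij : Fin (n H) ↔ Fin (n H')
    ebij : Fin (m H) ↔ Fin (m H')
    pres : ∀ j v → inc H' (Inverse.to ebij j) (Inverse.to vbij v) ≡ inc H j v

E₀ : Hypergraph
E₀ = hg 0 0 (λ ())

E₁ : Hypergraph
E₁ = hg 1 0 (λ ())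

_⊕_ : Hypergraph → Hypergraph → Hypergraph
H₁ ⊕ H₂ = hg (n H₁ +ℕ n H₂) (m H₁ +ℕ m H₂) incU
  where
  incU : Fin (m H₁ +ℕ m H₂) → Fin (n H₁ +ℕ n H₂) → Bool
  incU k v = [ (λ a → [ inc H₁ a , const false ] (splitAt (n H₁) v))
             , (λ b → [ const false , inc H₂ b ] (splitAt (n H₁) v)) ]
             (splitAt (m H₁) k)

_=ᶠ_ : ∀ {k} → Fin k → Fin k → Bool
i =ᶠ j = ⌊ i ≟ j ⌋

meets : ∀ {k} → (Fin k → Bool) → (Fin k → Bool) → Bool
meets {k} a b = any (λ v → a v ∧ b v) (allFin k)

partial : (H : Hypergraph) → (Fin (m H) → Bool) → Hypergraph
partial H J = hg (n H) (length E) (λ k → inc H (lookup E k))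
  where E = filterᵇ J (allFin (m H))

-- sub-hypergraph with vertices {v | P v} and edges (e_j)_{Q j}
-- (edges intersected with the new vertex set; used below only when the
-- selected edges lie inside the selected vertices)
sub : (H : Hypergraph) → (Fin (n H) → Bool) → (Fin (m H) → Bool) → Hypergraph
sub H P Q = hg (length L) (length E) (λ k w → inc H (lookup E k) (lookup L w))
  where
  L = filterᵇ P (allFin (n H))
  E = filterᵇ Q (allFin (m H))

_─_ : (H : Hypergraph) → Fin (m H) → Hypergraph
H ─ i = partial H (λ j → not (j =ᶠ i))

_†_ : (H : Hypergraph) → Fin (m H) → Hypergraph
H † i = sub H (λ v → not (inc H i v))
              (λ j → not (j =ᶠ i) ∧ not (meets (inc H j) (inc H i)))

-- contraction H / e_i ; the new vertex v_i is  zero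
_／_ : (H : Hypergraph) → Fin (m H) → Hypergraph
H ／ i = hg (suc (length L)) (length E) incC
  where
  L = filterᵇ (λ v → not (inc H i v)) (allFin (n H))
  E = filterᵇ (λ j → not (j =ᶠ i)) (allFin (m H))
  incC : Fin (length E) → Fin (suc (length L)) → Bool
  incC k zero    = meets (inc H (lookup E k)) (inc H i)
  incC k (suc w) = inc H (lookup E k) (lookup L w)

edgeSection : (H : Hypergraph) → (Fin (m H) → Bool) → Hypergraph
edgeSection H J = sub H (λ w → any (λ j → J j ∧ inc H j w) (allFin (m H))) J

iterate : ∀ {A : Set} → ℕ → (A → A) → A → A
iterate zero    g a = a
iterate (suc k) g a = g (iterate k g a)

step : (G : Hypergraph) → (Fin (n G) → Bool) → (Fin (n G) → Bool)
step G S w = S w ∨ any (λ j → inc G j w ∧ meets (inc G j) S) (allFin (m G))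

-- reach G u v: v lies in the connected component of u
-- (n(G) closure steps suffice)
reach : (G : Hypergraph) → Fin (n G) → Fin (n G) → Bool
reach G u = iterate (n G) (step G) (λ w → w =ᶠ u)

-- k(G): number of components = number of vertices that are the least
-- vertex of their component
k : Hypergraph → ℕ
k G = length (filterᵇ (λ v → not (any (λ u → (toℕ u <ᵇ toℕ v) ∧ reach G u v)
                                       (allFin (n G))))
                      (allFin (n G)))

-- pairs (A,B) of disjoint subsets of the edge index set, as labelings

data Lab : Set where
  none inA inB : Lab

isA isB isAB : Lab → Bool
isA inA = true
isA _   = false
isB inB = true
isB _   = false
isAB none = false
isAB _    = true

consL : ∀ {k} → Lab → (Fin k → Lab) → Fin (suc k) → Lab
consL x ℓ zero    = x
consL x ℓ (suc j) = ℓ j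

labelings : (k : ℕ) → List (Fin k → Lab)
labelings zero    = [ (λ ()) ]
labelings (suc k) = concatMap (λ ℓ → map (λ x → consL x ℓ) (none ∷ inA ∷ inB ∷ []))
                              (labelings k)

count : ∀ {k} → (Fin k → Bool) → ℕ
count {k} p = length (filterᵇ p (allFin k))

vertexDisjoint : (H : Hypergraph) → (Fin (m H) → Lab) → Bool
vertexDisjoint H ℓ =
  all (λ a → all (λ b → not (isA (ℓ a) ∧ isB (ℓ b) ∧ meets (inc H a) (inc H b)))
                 (allFin (m H)))
      (allFin (m H))

record IntegralDomain c ℓ : Set (lsuc (c ⊔ ℓ)) where
  field
    commutativeRing : CommutativeRing c ℓ
  open CommutativeRing commutativeRing
  field
    1≉0            : ¬ (1# ≈ 0#)
    noZeroDivisors : ∀ x y → x * y ≈ 0# → x ≈ 0# ⊎ y ≈ 0#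

module Xi {c ℓ} (D : IntegralDomain c ℓ) where
  open IntegralDomain D public
  open CommutativeRing commutativeRing public
  open import Algebra.Properties.Semiring.Exp semiring public using (_^_)

  xiGen : (H : Hypergraph) → Carrier → (ℕ → Carrier) → Carrier → Carrier
  xiGen H x ypow z =
    foldr _+_ 0# (map term (filterᵇ (vertexDisjoint H) (labelings (m H))))
    where
    term : (Fin (m H) → Lab) → Carrier
    term ℓ = x ^ (k (partial H (λ j → isAB (ℓ j))) ∸ kB)
             * ypow (count (λ j → isAB (ℓ j)) ∸ kB)
             * z ^ kB
      where kB = k (edgeSection H (λ j → isB (ℓ j)))

  ξ : Hypergraph → Carrier → Carrier → Carrier → Carrier
  ξ H x y z = xiGen H x (y ^_) z

  -- β^{m(H)} ξ(H; x, γ/β, z), computed without division: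
  -- β^{m(H)} (γ/β)^e = γ^e β^{m(H) - e}   (e ≤ m(H) always)
  βξ : Hypergraph → Carrier → Carrier → Carrier → Carrier → Carrier
  βξ H β x γ z = xiGen H x (λ e → γ ^ e * β ^ (m H ∸ e)) z

-- ξ(H; x, y, z) and β^m(H) ξ(H; x, γ/β, 0) are sums over the labelings of
-- the edges by none, A and B whose terms depend only on k(H_{A⊔B}), |A ⊔ B|
-- and k(H × B). Split such a sum by the label of an edge e: e labelled none
-- gives the sum for H - e; e labelled A or B and tied to the other labelled
-- edges gives y times the sum for H / e; e labelled B with every edge meeting
-- it labelled none forms a component of its own and gives z times the sum for
-- H † e. So both satisfy the deletion-contraction-extraction recurrence.
-- Conversely f is determined by α^n(H) on edgeless hypergraphs and by the
-- recurrence at the first edge. Expanding two small hypergraphs at two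
-- different edges forces δ (α - 1) (β - 1) = 0 and, if α = 1, also
-- δ (β - 1) (β + γ + δ - 1) = 0; in an integral domain the three cases remain.

module Submission where

open import Defs
open import Data.Nat.Base using (ℕ; zero; suc; _≤_; _<_; z≤n; s≤s; _∸_; _<ᵇ_) renaming (_+_ to _+ℕ_)
import Data.Nat.Properties as ℕₚ
open import Data.Nat.Properties using (module ≤-Reasoning; ≤-refl; ≤-trans; ≤-antisym; ≤-reflexive; <-irrefl; <-≤-trans; <-cmp; <ᵇ⇒<; <⇒<ᵇ; +-suc; +-monoʳ-≤; +-∸-assoc; m∸n≤m; ≤-pred)
open import Data.Fin.Base using (Fin; zero; suc; toℕ)
open import Data.Fin.Properties using (_≟_; injective⇒≤; toℕ-injective)
open import Data.Bool.Base using (Bool; true; false; not; _∧_; _∨_; T; if_then_else_)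
open import Data.Bool.Properties using (T?; T-irrelevant; ∧-identityʳ; not-involutive)
open import Data.List.Base using (List; []; _∷_; _++_; length; lookup; allFin; filterᵇ; map; foldr; concatMap; tabulate)
open import Data.List.Properties using (map-cong; map-tabulate; length-filter; length-tabulate; filter-≐)
open import Data.Bool.ListAction using (any; all)
open import Data.List.Membership.Propositional using (_∈_)
open import Data.List.Membership.Propositional.Properties using (∈-allFin; ∈-lookup; ∈-filter⁺; ∈-filter⁻)
import Data.List.Relation.Unary.Any as Any
import Data.List.Relation.Unary.Any.Properties as Anyₚ
import Data.List.Relation.Unary.All.Properties as Allₚ
open import Data.List.Relation.Unary.All as All using (All)
open import Data.List.Relation.Unary.AllPairs.Core using (_∷_)
open import Data.List.Relation.Unary.Unique.Propositional using (Unique)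
open import Data.List.Relation.Unary.Unique.Propositional.Properties using (filter⁺; allFin⁺)
open import Data.Product.Base using (∃; Σ; _×_; _,_; proj₁; proj₂)
open import Data.Sum.Base using (_⊎_; inj₁; inj₂; [_,_]′)
open import Data.Empty using (⊥; ⊥-elim)
open import Data.Unit.Base using (tt)
open import Function.Base using (id; _∘_)
open import Relation.Binary.Definitions using (tri<; tri≈; tri>)
open import Relation.Nullary using (¬_; yes; no; fromWitness; toWitness; fromWitnessFalse; toWitnessFalse)
open import Relation.Binary.PropositionalEquality using (_≡_; refl; sym; trans; cong; cong₂; subst; subst₂)
open import Function.Construct.Identity using (↔-id)

private variable
  A B : Set

∧-intro : ∀ {a b} → T a → T b → T (a ∧ b)
∧-intro {true} {true} _ _ = tt

∧-fst : ∀ {a b} → T (a ∧ b) → T a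
∧-fst {true} _ = tt

∧-snd : ∀ {a b} → T (a ∧ b) → T b
∧-snd {true} p = p

∨-inl : ∀ {a b} → T a → T (a ∨ b)
∨-inl {true} _ = tt

∨-inr : ∀ {a b} → T b → T (a ∨ b)
∨-inr {true}  _ = tt
∨-inr {false} p = p

∨-elim : ∀ {a b} {C : Set} → T (a ∨ b) → (T a → C) → (T b → C) → C
∨-elim {true}  _ f _ = f tt
∨-elim {false} p _ g = g p

not-intro : ∀ {a} → ¬ T a → T (not a)
not-intro {false} _ = tt
not-intro {true}  f = f tt

not-elim : ∀ {a} → T (not a) → ¬ T a
not-elim {false} _ ()

T-dec : ∀ a → T a ⊎ T (not a)
T-dec true  = inj₁ tt
T-dec false = inj₂ tt

T-ext : ∀ {a b} → (T a → T b) → (T b → T a) → a ≡ b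
T-ext {false} {false} _ _ = refl
T-ext {false} {true}  _ g = ⊥-elim (g tt)
T-ext {true}  {false} f _ = ⊥-elim (f tt)
T-ext {true}  {true}  _ _ = refl

T⇒≡true : ∀ {a} → T a → a ≡ true
T⇒≡true {true} _ = refl

≡true⇒T : ∀ {a} → a ≡ true → T a
≡true⇒T refl = tt

¬T⇒≡false : ∀ {a} → ¬ T a → a ≡ false
¬T⇒≡false {false} _ = refl
¬T⇒≡false {true}  f = ⊥-elim (f tt)

=ᶠ-refl : ∀ {k} (i : Fin k) → T (i =ᶠ i)
=ᶠ-refl i = fromWitness refl

=ᶠ⇒≡ : ∀ {k} {i j : Fin k} → T (i =ᶠ j) → i ≡ j
=ᶠ⇒≡ = toWitness

≢⇒not-=ᶠ : ∀ {k} {i j : Fin k} → ¬ i ≡ j → T (not (i =ᶠ j))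
≢⇒not-=ᶠ = fromWitnessFalse

not-=ᶠ⇒≢ : ∀ {k} {i j : Fin k} → T (not (i =ᶠ j)) → ¬ i ≡ j
not-=ᶠ⇒≢ = toWitnessFalse

=ᶠ-suc : ∀ {k} (i j : Fin k) → (suc i =ᶠ suc j) ≡ (i =ᶠ j)
=ᶠ-suc i j with i ≟ j
... | yes _ = refl
... | no  _ = refl

any-allFin⁺ : ∀ {n} (p : Fin n → Bool) i → T (p i) → T (any p (allFin n))
any-allFin⁺ p i q = Anyₚ.any⁺ p (Anyₚ.tabulate⁺ i q)

any-allFin⁻ : ∀ {n} (p : Fin n → Bool) → T (any p (allFin n)) → ∃ λ i → T (p i)
any-allFin⁻ p h = Anyₚ.tabulate⁻ (Anyₚ.any⁻ p _ h)

all-allFin⁺ : ∀ {n} (p : Fin n → Bool) → (∀ i → T (p i)) → T (all p (allFin n))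
all-allFin⁺ p f = Allₚ.all⁻ p (Allₚ.tabulate⁺ f)

all-allFin⁻ : ∀ {n} (p : Fin n → Bool) → T (all p (allFin n)) → ∀ i → T (p i)
all-allFin⁻ p h = Allₚ.tabulate⁻ (Allₚ.all⁺ p _ h)

any-cong : ∀ (p q : A → Bool) xs → (∀ x → p x ≡ q x) → any p xs ≡ any q xs
any-cong p q xs e = cong (foldr _∨_ false) (map-cong e xs)

all-cong : ∀ (p q : A → Bool) xs → (∀ x → p x ≡ q x) → all p xs ≡ all q xs
all-cong p q xs e = cong (foldr _∧_ true) (map-cong e xs)

meets⁺ : ∀ {k} (a b : Fin k → Bool) v → T (a v) → T (b v) → T (meets a b)
meets⁺ a b v p q = any-allFin⁺ (λ v → a v ∧ b v) v (∧-intro p q)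

meets⁻ : ∀ {k} (a b : Fin k → Bool) → T (meets a b) → ∃ λ v → T (a v) × T (b v)
meets⁻ a b h with any-allFin⁻ (λ v → a v ∧ b v) h
... | v , q = v , ∧-fst q , ∧-snd {a v} q

meets-sym : ∀ {k} (a b : Fin k → Bool) → T (meets a b) → T (meets b a)
meets-sym a b h with meets⁻ a b h
... | v , p , q = meets⁺ b a v q p

meets-cong : ∀ {k} (a a' b b' : Fin k → Bool) → (∀ v → a v ≡ a' v) → (∀ v → b v ≡ b' v) →
             meets a b ≡ meets a' b'
meets-cong {k} a a' b b' e f = any-cong _ _ (allFin k) (λ v → cong₂ _∧_ (e v) (f v))

filterᵇ-cong : ∀ (p q : A → Bool) xs → (∀ x → p x ≡ q x) → filterᵇ p xs ≡ filterᵇ q xs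
filterᵇ-cong p q xs e =
  filter-≐ (T? ∘ p) (T? ∘ q) ((λ {x} → subst T (e x)) , (λ {x} → subst T (sym (e x)))) xs

lookup-injective : ∀ (xs : List A) → Unique xs → ∀ i j → lookup xs i ≡ lookup xs j → i ≡ j
lookup-injective (x ∷ xs) (_ ∷ _) zero zero _ = refl
lookup-injective (x ∷ xs) (x∉ ∷ _) zero (suc j) e = ⊥-elim (All.lookup x∉ (∈-lookup j) e)
lookup-injective (x ∷ xs) (x∉ ∷ _) (suc i) zero e = ⊥-elim (All.lookup x∉ (∈-lookup i) (sym e))
lookup-injective (x ∷ xs) (_ ∷ u) (suc i) (suc j) e = cong suc (lookup-injective xs u i j e)

module _ {n : ℕ} (p : Fin n → Bool) where

  selected : List (Fin n)
  selected = filterᵇ p (allFin n)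

  selected-unique : Unique selected
  selected-unique = filter⁺ (T? ∘ p) (allFin⁺ n)

  select : Fin (count p) → Fin n
  select = lookup selected

  select-sat : ∀ k → T (p (select k))
  select-sat k = proj₂ (∈-filter⁻ (T? ∘ p) {xs = allFin n} (∈-lookup k))

  select-injective : ∀ i j → select i ≡ select j → i ≡ j
  select-injective = lookup-injective selected selected-unique

  private
    ∈-selected : ∀ x → T (p x) → x ∈ selected
    ∈-selected x q = ∈-filter⁺ (T? ∘ p) (∈-allFin x) q

  rank : ∀ x → T (p x) → Fin (count p)
  rank x q = Any.index (∈-selected x q)

  select-rank : ∀ x q → select (rank x q) ≡ x
  select-rank x q = sym (Anyₚ.lookup-index (∈-selected x q))

  rank-select : ∀ k q → rank (select k) q ≡ k
  rank-select k q = select-injective _ _ (select-rank (select k) q)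

  rank-injective : ∀ x y q q' → rank x q ≡ rank y q' → x ≡ y
  rank-injective x y q q' e = trans (sym (select-rank x q)) (trans (cong select e) (select-rank y q'))

count-≤-injection : ∀ {n n'} (p : Fin n → Bool) (p' : Fin n' → Bool)
  (f : ∀ i → T (p i) → Fin n') → (∀ i q → T (p' (f i q))) →
  (∀ i j q q' → f i q ≡ f j q' → i ≡ j) → count p ≤ count p'
count-≤-injection p p' f f-sat f-injective = injective⇒≤ {f = g} g-injective
  where
  g : Fin (count p) → Fin (count p')
  g r = rank p' (f (select p r) (select-sat p r)) (f-sat _ _)
  g-injective : ∀ {x y} → g x ≡ g y → x ≡ y
  g-injective {x} {y} e = select-injective p x y (f-injective _ _ _ _ (rank-injective p' _ _ _ _ e))

count-mono : ∀ {n} (p q : Fin n → Bool) → (∀ j → T (p j) → T (q j)) → count p ≤ count q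
count-mono p q p⊆q = count-≤-injection p q (λ j _ → j) p⊆q (λ _ _ _ _ e → e)

count-cong : ∀ {n} (p q : Fin n → Bool) → (∀ x → p x ≡ q x) → count p ≡ count q
count-cong {n} p q e = cong length (filterᵇ-cong p q (allFin n) e)

count≤size : ∀ {n} (p : Fin n → Bool) → count p ≤ n
count≤size {n} p = ≤-trans (length-filter (T? ∘ p) (allFin n)) (≤-reflexive (length-tabulate id))

count-positive : ∀ {n} (p : Fin n → Bool) x → T (p x) → 1 ≤ count p
count-positive p x px with count p | rank p x px
... | suc _ | _ = s≤s z≤n

count≡1 : ∀ {n} (p : Fin n → Bool) x → T (p x) → (∀ y z → T (p y) → T (p z) → y ≡ z) → count p ≡ 1
count≡1 p x px unique = ≤-antisym at-most-one (count-positive p x px)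
  where
  at-most-one : count p ≤ 1
  at-most-one = injective⇒≤ {f = λ _ → zero}
    (λ {a} {b} _ → select-injective p a b (unique _ _ (select-sat p a) (select-sat p b)))

length-filterᵇ-split : ∀ (p q : A → Bool) xs →
  length (filterᵇ p xs) ≡ length (filterᵇ (λ x → p x ∧ q x) xs) +ℕ length (filterᵇ (λ x → p x ∧ not (q x)) xs)
length-filterᵇ-split p q [] = refl
length-filterᵇ-split p q (x ∷ xs) with p x | q x
... | true  | true  = cong suc (length-filterᵇ-split p q xs)
... | true  | false = trans (cong suc (length-filterᵇ-split p q xs)) (sym (+-suc _ _))
... | false | _     = length-filterᵇ-split p q xs

count-split : ∀ {n} (p q : Fin n → Bool) → count p ≡ count (λ x → p x ∧ q x) +ℕ count (λ x → p x ∧ not (q x))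
count-split {n} p q = length-filterᵇ-split p q (allFin n)

count-strict-mono : ∀ {n} (p q : Fin n → Bool) → (∀ w → T (p w) → T (q w)) →
  ∀ w → T (q w) → T (not (p w)) → suc (count p) ≤ count q
count-strict-mono p q p⊆q w qw ¬pw = begin
  suc (count p)                                   ≡⟨ ℕₚ.+-comm 1 (count p) ⟩
  count p +ℕ 1                                    ≤⟨ +-monoʳ-≤ (count p) (count-positive q∖p w (∧-intro qw ¬pw)) ⟩
  count p +ℕ count q∖p                            ≡⟨ cong (_+ℕ count q∖p) (sym q∩p≡p) ⟩
  count (λ x → q x ∧ p x) +ℕ count q∖p            ≡⟨ sym (count-split q p) ⟩
  count q                                         ∎
  where
  open ≤-Reasoning
  q∖p : Fin _ → Bool
  q∖p x = q x ∧ not (p x)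
  q∩p≡p : count (λ x → q x ∧ p x) ≡ count p
  q∩p≡p = count-cong _ _ (λ x → T-ext (∧-snd {q x}) (λ h → ∧-intro (p⊆q x h) h))

count-true : ∀ n → count {n} (λ _ → true) ≡ n
count-true n = trans (cong length (keep-all (allFin n))) (length-tabulate id)
  where
  keep-all : ∀ (xs : List (Fin n)) → filterᵇ (λ _ → true) xs ≡ xs
  keep-all [] = refl
  keep-all (x ∷ xs) = cong (x ∷_) (keep-all xs)

count-false : ∀ n → count {n} (λ _ → false) ≡ 0
count-false n = cong length (drop-all (allFin n))
  where
  drop-all : ∀ (xs : List (Fin n)) → filterᵇ (λ _ → false) xs ≡ []
  drop-all [] = refl
  drop-all (x ∷ xs) = drop-all xs

count-restrict : ∀ {n} (J p : Fin n → Bool) → (∀ j → T (p j) → T (J j)) → count p ≡ count (p ∘ select J)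
count-restrict J p p⊆J = ≤-antisym
  (count-≤-injection p (p ∘ select J) (λ j q → rank J j (p⊆J j q))
     (λ j q → subst (T ∘ p) (sym (select-rank J j (p⊆J j q))) q)
     (λ i j _ _ e → rank-injective J i j _ _ e))
  (count-≤-injection (p ∘ select J) p (λ k _ → select J k) (λ _ q → q) (λ i j _ _ e → select-injective J i j e))

count-nonzero : ∀ m → count {suc m} (λ j → not (j =ᶠ zero)) ≡ m
count-nonzero m = keep-suc suc (λ _ → tt)
  where
  keep-suc : ∀ {k} (f : Fin k → Fin (suc m)) → (∀ i → T (not (f i =ᶠ zero))) →
             length (filterᵇ (λ j → not (j =ᶠ zero)) (tabulate f)) ≡ k
  keep-suc {zero} f h = refl
  keep-suc {suc k} f h with not (f zero =ᶠ zero) | h zero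
  ... | true | _ = cong suc (keep-suc (f ∘ suc) (h ∘ suc))

count-≤-pred : ∀ {m} (p : Fin (suc m) → Bool) → T (not (p zero)) → count p ≤ m
count-≤-pred {m} p ¬p0 with p zero | ¬p0
... | false | _ = ≤-trans (length-filter (T? ∘ p) (tabulate suc)) (≤-reflexive (length-tabulate suc))

data Path (G : Hypergraph) (J : Fin (m G) → Bool) (u : Fin (n G)) : Fin (n G) → Set where
  here : Path G J u u
  via  : ∀ {w v} (j : Fin (m G)) → Path G J u w → T (J j) → T (inc G j w) → T (inc G j v) → Path G J u v

Connected : (G : Hypergraph) → Fin (n G) → Fin (n G) → Set
Connected G = Path G (λ _ → true)

module _ {G : Hypergraph} {J : Fin (m G) → Bool} where

  Path-edge : ∀ {u v} j → T (J j) → T (inc G j u) → T (inc G j v) → Path G J u v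
  Path-edge j q a b = via j here q a b

  Path-trans : ∀ {u w v} → Path G J u w → Path G J w v → Path G J u v
  Path-trans p here = p
  Path-trans p (via j q x a b) = via j (Path-trans p q) x a b

  Path-sym : ∀ {u v} → Path G J u v → Path G J v u
  Path-sym here = here
  Path-sym (via j p x a b) = Path-trans (Path-edge j x b a) (Path-sym p)

-- reach G u is the n(G)-th iterate of a closure step; it is closed already
-- because each non-closed step adds a vertex.
module Closure (G : Hypergraph) (u : Fin (n G)) where

  reached : ℕ → Fin (n G) → Bool
  reached j = iterate j (step G) (_=ᶠ u)

  Closed : (Fin (n G) → Bool) → Set
  Closed P = ∀ w → T (step G P w) → T (P w)

  reached-suc : ∀ j w → T (reached j w) → T (reached (suc j) w)
  reached-suc j w = ∨-inl

  reached-start : ∀ j → T (reached j u)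
  reached-start zero = =ᶠ-refl u
  reached-start (suc j) = reached-suc j u (reached-start j)

  reached⇒Connected : ∀ j w → T (reached j w) → Connected G u w
  reached⇒Connected zero w h = subst (Connected G u) (sym (=ᶠ⇒≡ h)) here
  reached⇒Connected (suc j) w h = ∨-elim {reached j w} h (reached⇒Connected j w) λ a →
    let (e , q) = any-allFin⁻ _ a
        (x , ex , sx) = meets⁻ (inc G e) (reached j) (∧-snd {inc G e w} q)
    in via e (reached⇒Connected j x sx) tt ex (∧-fst q)

  step-cong : ∀ (P P' : Fin (n G) → Bool) → (∀ w → P w ≡ P' w) → ∀ w → step G P w ≡ step G P' w
  step-cong P P' e w = cong₂ _∨_ (e w) (any-cong _ _ (allFin (m G))
    (λ j → cong (inc G j w ∧_) (meets-cong _ _ _ _ (λ _ → refl) e)))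

  Closed-suc : ∀ j → Closed (reached j) → Closed (reached (suc j))
  Closed-suc j cl w h = reached-suc j w (cl w (subst T (step-cong (reached (suc j)) (reached j)
                          (λ x → T-ext (cl x) (reached-suc j x)) w) h))

  closed-or-growing : ∀ j → Closed (reached j) ⊎ j < count (reached j)
  closed-or-growing zero = inj₂ (count-positive (reached 0) u (=ᶠ-refl u))
  closed-or-growing (suc j) with closed-or-growing j
  ... | inj₁ cl = inj₁ (Closed-suc j cl)
  ... | inj₂ lt with T-dec (any (λ w → step G (reached j) w ∧ not (reached j w)) (allFin (n G)))
  ... | inj₁ grows = let (w , h) = any-allFin⁻ _ grows in
    inj₂ (≤-trans (s≤s lt) (count-strict-mono (reached j) (reached (suc j)) (reached-suc j) w
                              (∧-fst h) (∧-snd {step G (reached j) w} h)))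
  ... | inj₂ stuck = inj₁ (Closed-suc j closed)
    where
    closed : Closed (reached j)
    closed w h with T-dec (reached j w)
    ... | inj₁ r = r
    ... | inj₂ ¬r = ⊥-elim (not-elim stuck (any-allFin⁺ _ w (∧-intro h ¬r)))

  closed : Closed (reached (n G))
  closed with closed-or-growing (n G)
  ... | inj₁ cl = cl
  ... | inj₂ lt = ⊥-elim (<-irrefl refl (<-≤-trans lt (count≤size (reached (n G)))))

  Connected⇒reached : ∀ {w} → Connected G u w → T (reached (n G) w)
  Connected⇒reached here = reached-start (n G)
  Connected⇒reached {w} (via {x} e p _ a b) = closed w (∨-inr {reached (n G) w}
    (any-allFin⁺ _ e (∧-intro b (meets⁺ (inc G e) (reached (n G)) x a (Connected⇒reached p)))))

reach⇒Connected : ∀ G u v → T (reach G u v) → Connected G u v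
reach⇒Connected G u v = Closure.reached⇒Connected G u (n G) v

Connected⇒reach : ∀ G u v → Connected G u v → T (reach G u v)
Connected⇒reach G u v = Closure.Connected⇒reached G u

isRoot : (G : Hypergraph) → Fin (n G) → Bool
isRoot G v = not (any (λ u → (toℕ u <ᵇ toℕ v) ∧ reach G u v) (allFin (n G)))

rootsIn : (G : Hypergraph) → (Fin (n G) → Bool) → ℕ
rootsIn G Q = count (λ v → isRoot G v ∧ Q v)

rootsIn-all : ∀ G (Q : Fin (n G) → Bool) → (∀ v → T (Q v)) → rootsIn G Q ≡ k G
rootsIn-all G Q all-Q = count-cong _ _ (λ v → trans (cong (isRoot G v ∧_) (T⇒≡true (all-Q v))) (∧-identityʳ _))

module _ (G : Hypergraph) where

  root-minimal : ∀ v → T (isRoot G v) → ∀ u → toℕ u < toℕ v → ¬ Connected G u v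
  root-minimal v r u lt c = not-elim r (any-allFin⁺ _ u (∧-intro (<⇒<ᵇ lt) (Connected⇒reach G u v c)))

  root-exists : ∀ w → Σ (Fin (n G)) λ v → T (isRoot G v) × Connected G v w
  root-exists w = descend (suc (toℕ w)) w ≤-refl
    where
    descend : ∀ bound w → toℕ w < bound → Σ (Fin (n G)) λ v → T (isRoot G v) × Connected G v w
    descend (suc bound) w lt with T-dec (isRoot G w)
    ... | inj₁ r = w , r , here
    ... | inj₂ ¬r with any-allFin⁻ _ (subst T (not-involutive _) ¬r)
    ... | u , q with descend bound u (≤-trans (<ᵇ⇒< _ _ (∧-fst q)) (≤-pred lt))
    ... | v , r , c = v , r , Path-trans c (reach⇒Connected G u w (∧-snd {toℕ u <ᵇ toℕ w} q))

  root-unique : ∀ v v' → T (isRoot G v) → T (isRoot G v') → Connected G v v' → v ≡ v'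
  root-unique v v' r r' c with <-cmp (toℕ v) (toℕ v')
  ... | tri< lt _ _ = ⊥-elim (root-minimal v' r' v lt c)
  ... | tri≈ _ e _  = toℕ-injective e
  ... | tri> _ _ gt = ⊥-elim (root-minimal v r v' gt (Path-sym c))

-- Send each root to the root of the component of its image; reflecting
-- connectivity makes this injective.
rootsIn-≤ : ∀ (G G' : Hypergraph) (Q : Fin (n G) → Bool) (Q' : Fin (n G') → Bool)
  (φ : ∀ u → T (Q u) → Fin (n G')) → (∀ u q → T (Q' (φ u q))) →
  (∀ u v q q' → Connected G' (φ u q) (φ v q') → Connected G u v) →
  (∀ u v → T (Q' u) → Connected G' u v → T (Q' v)) →
  rootsIn G Q ≤ rootsIn G' Q'
rootsIn-≤ G G' Q Q' φ φ-in φ-reflects Q'-closed =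
  count-≤-injection (λ v → isRoot G v ∧ Q v) (λ v → isRoot G' v ∧ Q' v) ρ ρ-sat ρ-injective
  where
  ρ : ∀ v → T (isRoot G v ∧ Q v) → Fin (n G')
  ρ v q = proj₁ (root-exists G' (φ v (∧-snd {isRoot G v} q)))
  ρ-sat : ∀ v q → T (isRoot G' (ρ v q) ∧ Q' (ρ v q))
  ρ-sat v q with root-exists G' (φ v (∧-snd {isRoot G v} q))
  ... | r , r-root , c = ∧-intro r-root (Q'-closed _ _ (φ-in v _) (Path-sym c))
  ρ-injective : ∀ v w q q' → ρ v q ≡ ρ w q' → v ≡ w
  ρ-injective v w q q' e with root-exists G' (φ v (∧-snd {isRoot G v} q)) | root-exists G' (φ w (∧-snd {isRoot G w} q'))
  ... | r , _ , c | r' , _ , c' =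
    root-unique G v w (∧-fst q) (∧-fst q')
      (φ-reflects v w _ _ (Path-trans (Path-sym c) (subst (λ z → Connected G' z (φ w _)) (sym e) c')))

record PathEmbedding (G H : Hypergraph) (JG : Fin (m G) → Bool) (JH : Fin (m H) → Bool) : Set where
  field
    ι    : Fin (n G) → Fin (n H)
    to   : ∀ {u v} → Path G JG u v → Path H JH (ι u) (ι v)
    from : ∀ {u v} → Path H JH (ι u) (ι v) → Path G JG u v
open PathEmbedding public

_∘ᴱ_ : ∀ {G H K JG JH JK} → PathEmbedding H K JH JK → PathEmbedding G H JG JH → PathEmbedding G K JG JK
f ∘ᴱ e = record { ι = ι f ∘ ι e ; to = λ c → to f (to e c) ; from = λ c → from e (from f c) }

-- Both G and G' meet every J-component of H inside Q, so both count these.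
module _ {G G' H : Hypergraph} {J : Fin (m H) → Bool}
  (e : PathEmbedding G H (λ _ → true) J) (e' : PathEmbedding G' H (λ _ → true) J)
  (Q : Fin (n H) → Bool) (Q-closed : ∀ x y → T (Q x) → Path H J x y → T (Q y))
  (cover : ∀ x → T (Q x) → Σ (Fin (n G)) λ u → Path H J x (ι e u))
  (cover' : ∀ x → T (Q x) → Σ (Fin (n G')) λ u → Path H J x (ι e' u)) where

  private
    half : ∀ {G G'} (e : PathEmbedding G H (λ _ → true) J) (e' : PathEmbedding G' H (λ _ → true) J) →
           (∀ x → T (Q x) → Σ (Fin (n G')) λ u → Path H J x (ι e' u)) →
           rootsIn G (Q ∘ ι e) ≤ rootsIn G' (Q ∘ ι e')
    half {G} {G'} e e' cover' = rootsIn-≤ G G' (Q ∘ ι e) (Q ∘ ι e') φ φ-in φ-reflects Q'-closed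
      where
      φ : ∀ u → T (Q (ι e u)) → Fin (n G')
      φ u q = proj₁ (cover' (ι e u) q)
      φ-in : ∀ u q → T (Q (ι e' (φ u q)))
      φ-in u q = Q-closed _ _ q (proj₂ (cover' (ι e u) q))
      φ-reflects : ∀ u v q q' → Connected G' (φ u q) (φ v q') → Connected G u v
      φ-reflects u v q q' c = from e (Path-trans (proj₂ (cover' (ι e u) q))
                                (Path-trans (to e' c) (Path-sym (proj₂ (cover' (ι e v) q')))))
      Q'-closed : ∀ u v → T (Q (ι e' u)) → Connected G' u v → T (Q (ι e' v))
      Q'-closed u v q c = Q-closed _ _ q (to e' c)

  rootsIn-≡ : rootsIn G (Q ∘ ι e) ≡ rootsIn G' (Q ∘ ι e')
  rootsIn-≡ = ≤-antisym (half e e' cover') (half e' e cover)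

  k-≡ : (∀ u → T (Q (ι e u))) → (∀ u → T (Q (ι e' u))) → k G ≡ k G'
  k-≡ in-Q in-Q' = trans (sym (rootsIn-all G (Q ∘ ι e) in-Q)) (trans rootsIn-≡ (rootsIn-all G' (Q ∘ ι e') in-Q'))

sameVertices-embedding : ∀ {N mG mH} (iG : Fin mG → Fin N → Bool) (iH : Fin mH → Fin N → Bool)
  (JG : Fin mG → Bool) (JH : Fin mH → Bool) (η : Fin mG → Fin mH) →
  (∀ k v → iG k v ≡ iH (η k) v) → (∀ k → T (JG k) → T (JH (η k))) →
  (∀ j → T (JH j) → Σ (Fin mG) λ k → T (JG k) × (∀ v → iH j v ≡ iG k v)) →
  PathEmbedding (hg N mG iG) (hg N mH iH) JG JH
sameVertices-embedding {N} {mG} {mH} iG iH JG JH η inc-η J-η η-onto =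
  record { ι = id ; to = forth ; from = back }
  where
  forth : ∀ {u v} → Path (hg N mG iG) JG u v → Path (hg N mH iH) JH u v
  forth here = here
  forth (via k c q a b) = via (η k) (forth c) (J-η k q) (subst T (inc-η k _) a) (subst T (inc-η k _) b)
  back : ∀ {u v} → Path (hg N mH iH) JH u v → Path (hg N mG iG) JG u v
  back here = here
  back (via j c q a b) with η-onto j q
  ... | k , qk , e = via k (back c) qk (subst T (e _) a) (subst T (e _) b)

partial-embedding : ∀ H (J : Fin (m H) → Bool) → PathEmbedding (partial H J) H (λ _ → true) J
partial-embedding H J = sameVertices-embedding _ (inc H) _ J (select J) (λ _ _ → refl) (λ k _ → select-sat J k)
  (λ j q → rank J j q , tt , (λ v → cong (λ z → inc H z v) (sym (select-rank J j q))))

partial-embeddingʳ : ∀ H (J₀ J : Fin (m H) → Bool) → (∀ j → T (J j) → T (J₀ j)) →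
  PathEmbedding (partial H J₀) H (J ∘ select J₀) J
partial-embeddingʳ H J₀ J J⊆J₀ = sameVertices-embedding _ (inc H) _ J (select J₀) (λ _ _ → refl) (λ _ q → q)
  (λ j q → rank J₀ j (J⊆J₀ j q) , subst (T ∘ J) (sym (select-rank J₀ j (J⊆J₀ j q))) q ,
           (λ v → cong (λ z → inc H z v) (sym (select-rank J₀ j (J⊆J₀ j q)))))

module _ (H : Hypergraph) (P : Fin (n H) → Bool) (Q : Fin (m H) → Bool)
  (Js : Fin (count Q) → Bool) (J : Fin (m H) → Bool)
  (Js⇒J : ∀ k → T (Js k) → T (J (select Q k)))
  (J-inside : ∀ j w → T (J j) → T (P w) → T (inc H j w) →
              (∀ v → T (inc H j v) → T (P v)) × Σ (Fin (count Q)) λ k → select Q k ≡ j × T (Js k)) where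

  private
    G : Hypergraph
    G = sub H P Q

    forth : ∀ {u v} → Path G Js u v → Path H J (select P u) (select P v)
    forth here = here
    forth (via k c q a b) = via (select Q k) (forth c) (Js⇒J k q) a b

    stays : ∀ {x y} → Path H J x y → T (P x) →
            T (P y) × ((qx : T (P x)) (qy : T (P y)) → Path G Js (rank P x qx) (rank P y qy))
    stays here px = px , λ qx qy → subst (λ z → Path G Js (rank P _ qx) (rank P _ z)) (T-irrelevant qx qy) here
    stays {x} {y} (via {w} j c q a b) px with stays c px
    ... | pw , path with J-inside j w q pw a
    ... | inside , k , e , jk = inside y b , λ qx qy → via k (path qx pw) jk
          (subst T (cong₂ (inc H) (sym e) (sym (select-rank P w pw))) a)
          (subst T (cong₂ (inc H) (sym e) (sym (select-rank P y qy))) b)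

    back : ∀ {u v} → Path H J (select P u) (select P v) → Path G Js u v
    back {u} {v} c = subst₂ (Path G Js) (rank-select P u _) (rank-select P v _)
      (proj₂ (stays c (select-sat P u)) (select-sat P u) (select-sat P v))

  sub-embedding : PathEmbedding G H Js J
  sub-embedding = record { ι = select P ; to = forth ; from = back }

avoid : ∀ (H : Hypergraph) (i : Fin (m H)) (J : Fin (m H) → Bool) →
  (∀ j → T (J j) → ¬ j ≡ i → T (not (meets (inc H j) (inc H i)))) →
  ∀ {x y} → Path H J x y → T (not (inc H i x)) → T (not (inc H i y))
avoid H i J apart here ¬x = ¬x
avoid H i J apart (via {w} j c q a b) ¬x =
  not-intro (λ iy → not-elim (apart j q j≢i) (meets⁺ (inc H j) (inc H i) _ b iy))
  where
  ¬w = avoid H i J apart c ¬x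
  j≢i : ¬ j ≡ i
  j≢i refl = not-elim ¬w a

-- lift sends the new vertex of H / eᵢ to a chosen c ∈ eᵢ; as eᵢ is a J-edge,
-- all of eᵢ is J-connected to c.
module Contraction (H : Hypergraph) (i : Fin (m H)) (c : Fin (n H)) (c∈eᵢ : T (inc H i c))
  (J : Fin (m H) → Bool) (Jᵢ : T (J i)) where

  outside : Fin (n H) → Bool
  outside v = not (inc H i v)

  others : Fin (m H) → Bool
  others j = not (j =ᶠ i)

  C : Hypergraph
  C = H ／ i

  lift : Fin (suc (count outside)) → Fin (n H)
  lift zero    = c
  lift (suc w) = select outside w

  project : Fin (n H) → Fin (suc (count outside))
  project x with T-dec (inc H i x)
  ... | inj₁ _ = zero
  ... | inj₂ q = suc (rank outside x q)

  project-in : ∀ x → T (inc H i x) → project x ≡ zero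
  project-in x x∈ with T-dec (inc H i x)
  ... | inj₁ _ = refl
  ... | inj₂ q = ⊥-elim (not-elim q x∈)

  project-out : ∀ x (q : T (outside x)) → project x ≡ suc (rank outside x q)
  project-out x q with T-dec (inc H i x)
  ... | inj₁ x∈ = ⊥-elim (not-elim q x∈)
  ... | inj₂ q' = cong (λ z → suc (rank outside x z)) (T-irrelevant q' q)

  project-lift : ∀ a → project (lift a) ≡ a
  project-lift zero = project-in c c∈eᵢ
  project-lift (suc w) = trans (project-out (select outside w) (select-sat outside w)) (cong suc (rank-select outside w _))

  lift-project : ∀ x → Path H J x (lift (project x))
  lift-project x with T-dec (inc H i x)
  ... | inj₁ x∈ = Path-edge i Jᵢ x∈ c∈eᵢ
  ... | inj₂ q = subst (Path H J x) (sym (select-rank outside x q)) here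

  inc-project : ∀ k x → T (inc H (select others k) x) → T (inc C k (project x))
  inc-project k x a with T-dec (inc H i x)
  ... | inj₁ x∈ = meets⁺ (inc H (select others k)) (inc H i) x a x∈
  ... | inj₂ q = subst (λ z → T (inc H (select others k) z)) (sym (select-rank outside x q)) a

  private
    Jᶜ : Fin (count others) → Bool
    Jᶜ = J ∘ select others

    forth : ∀ {x y} → Path H J x y → Path C Jᶜ (project x) (project y)
    forth here = here
    forth {x} {y} (via {w} j c' q a b) with j ≟ i
    ... | yes refl = subst (Path C Jᶜ (project x)) (trans (project-in w a) (sym (project-in y b))) (forth c')
    ... | no j≢i = via r (forth c') (subst (T ∘ J) (sym e) q)
                     (inc-project r w (subst (λ z → T (inc H z w)) (sym e) a))
                     (inc-project r y (subst (λ z → T (inc H z y)) (sym e) b))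
      where
      r = rank others j (≢⇒not-=ᶠ j≢i)
      e : select others r ≡ j
      e = select-rank others j (≢⇒not-=ᶠ j≢i)

    witness : ∀ k a → T (inc C k a) → Σ (Fin (n H)) λ y → T (inc H (select others k) y) × Path H J (lift a) y
    witness k zero h with meets⁻ (inc H (select others k)) (inc H i) h
    ... | y , y∈ , y∈eᵢ = y , y∈ , Path-edge i Jᵢ c∈eᵢ y∈eᵢ
    witness k (suc w) h = select outside w , h , here

    back : ∀ {u v} → Path C Jᶜ u v → Path H J (lift u) (lift v)
    back here = here
    back (via {w} {v} k c' q a b) with witness k w a | witness k v b
    ... | y , y∈ , cy | y' , y'∈ , cy' =
      Path-trans (back c') (Path-trans cy (Path-trans (Path-edge (select others k) q y∈ y'∈) (Path-sym cy')))

  contraction-embedding : PathEmbedding C H Jᶜ J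
  contraction-embedding = record
    { ι = lift ; to = back ; from = λ {u} {v} h → subst₂ (Path C Jᶜ) (project-lift u) (project-lift v) (forth h) }

inSection : (G : Hypergraph) → (Fin (m G) → Bool) → Fin (n G) → Bool
inSection G B w = any (λ j → B j ∧ inc G j w) (allFin (m G))

inSection⁺ : ∀ G B j w → T (B j) → T (inc G j w) → T (inSection G B w)
inSection⁺ G B j w b i = any-allFin⁺ (λ j → B j ∧ inc G j w) j (∧-intro b i)

inSection⁻ : ∀ G B w → T (inSection G B w) → Σ (Fin (m G)) λ j → T (B j) × T (inc G j w)
inSection⁻ G B w h with any-allFin⁻ (λ j → B j ∧ inc G j w) h
... | j , q = j , ∧-fst q , ∧-snd {B j} q

inSection-closed : ∀ (G : Hypergraph) B x y → T (inSection G B x) → Path G B x y → T (inSection G B y)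
inSection-closed G B x y px here = px
inSection-closed G B x y px (via j _ q a b) = inSection⁺ G B j y q b

edgeSection-embedding : ∀ G (B : Fin (m G) → Bool) → PathEmbedding (edgeSection G B) G (λ _ → true) B
edgeSection-embedding G B = sub-embedding G (inSection G B) B (λ _ → true) B (λ k _ → select-sat B k)
  (λ j w q _ _ → (λ v iv → inSection⁺ G B j v q iv) , rank B j q , select-rank B j q , tt)

edgeSection-cover : ∀ G B x → T (inSection G B x) →
  Σ (Fin (count (inSection G B))) λ u → Path G B x (ι (edgeSection-embedding G B) u)
edgeSection-cover G B x q = rank (inSection G B) x q , subst (Path G B x) (sym (select-rank (inSection G B) x q)) here

partial-cong : ∀ G (J J' : Fin (m G) → Bool) → (∀ j → J j ≡ J' j) → partial G J ≡ partial G J'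
partial-cong G J J' e = cong (λ E → hg (n G) (length E) (λ k → inc G (lookup E k))) (filterᵇ-cong J J' (allFin (m G)) e)

edgeSection-cong : ∀ G (J J' : Fin (m G) → Bool) → (∀ j → J j ≡ J' j) → edgeSection G J ≡ edgeSection G J'
edgeSection-cong G J J' e = cong₂ (λ L E → hg (length L) (length E) (λ k w → inc G (lookup E k) (lookup L w)))
  (filterᵇ-cong _ _ (allFin (n G)) (λ w → any-cong _ _ (allFin (m G)) (λ j → cong (_∧ inc G j w) (e j))))
  (filterᵇ-cong J J' (allFin (m G)) e)

k-edgeSection≤ : ∀ G (B : Fin (m G) → Bool) → k (edgeSection G B) ≤ count B
k-edgeSection≤ G B = subst (_≤ count B) (rootsIn-all S (λ _ → true) (λ _ → tt))
  (≤-trans (count-≤-injection _ (λ _ → true) edgeOf (λ _ _ → tt) edgeOf-injective) (≤-reflexive (count-true (count B))))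
  where
  S = edgeSection G B
  P = inSection G B
  edge∋ : ∀ v → Σ (Fin (m G)) λ j → T (B j) × T (inc G j (select P v))
  edge∋ v = inSection⁻ G B (select P v) (select-sat P v)
  edgeOf : ∀ v → T (isRoot S v ∧ true) → Fin (count B)
  edgeOf v _ = rank B (proj₁ (edge∋ v)) (proj₁ (proj₂ (edge∋ v)))
  edgeOf-injective : ∀ v w q q' → edgeOf v q ≡ edgeOf w q' → v ≡ w
  edgeOf-injective v w q q' e = root-unique S v w (∧-fst q) (∧-fst q') (Path-edge {J = λ _ → true} r tt v∈ w∈)
    where
    j = proj₁ (edge∋ v)
    bj = proj₁ (proj₂ (edge∋ v))
    r = rank B j bj
    same : j ≡ proj₁ (edge∋ w)
    same = rank-injective B _ _ _ _ e
    v∈ : T (inc G (select B r) (select P v))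
    v∈ = subst (λ z → T (inc G z (select P v))) (sym (select-rank B j bj)) (proj₂ (proj₂ (edge∋ v)))
    w∈ : T (inc G (select B r) (select P w))
    w∈ = subst (λ z → T (inc G z (select P w))) (sym (trans (select-rank B j bj) same)) (proj₂ (proj₂ (edge∋ w)))

isNone : Lab → Bool
isNone none = true
isNone _    = false

_=ˡ_ : Lab → Lab → Bool
none =ˡ none = true
inA  =ˡ inA  = true
inB  =ˡ inB  = true
_    =ˡ _    = false

=ˡ-sym : ∀ x y → (x =ˡ y) ≡ (y =ˡ x)
=ˡ-sym none none = refl
=ˡ-sym none inA  = refl
=ˡ-sym none inB  = refl
=ˡ-sym inA  none = refl
=ˡ-sym inA  inA  = refl
=ˡ-sym inA  inB  = refl
=ˡ-sym inB  none = refl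
=ˡ-sym inB  inA  = refl
=ˡ-sym inB  inB  = refl

labels : List Lab
labels = none ∷ inA ∷ inB ∷ []

update : ∀ {M} → (Fin M → Lab) → Fin M → Lab → Fin M → Lab
update ℓ x y j = if j =ᶠ x then y else ℓ j

memb : ∀ {M} → Fin M → List (Fin M) → Bool
memb j E = any (j =ᶠ_) E

noneOutside : ∀ {M} → List (Fin M) → (Fin M → Lab) → Bool
noneOutside {M} E ℓ = all (λ j → memb j E ∨ isNone (ℓ j)) (allFin M)

memb⇒∈ : ∀ {M} {j : Fin M} E → T (memb j E) → j ∈ E
memb⇒∈ E h = Any.map =ᶠ⇒≡ (Anyₚ.any⁻ _ E h)

memb-selected⁻ : ∀ {M} (p : Fin M → Bool) j → T (memb j (selected p)) → T (p j)
memb-selected⁻ {M} p j h = proj₂ (∈-filter⁻ (T? ∘ p) {xs = allFin M} (memb⇒∈ (selected p) h))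

memb-selected⁺ : ∀ {M} (p : Fin M → Bool) j → T (p j) → T (memb j (selected p))
memb-selected⁺ p j q = Anyₚ.any⁺ _ (Any.map (λ { refl → =ᶠ-refl j }) (∈-filter⁺ (T? ∘ p) (∈-allFin j) q))

all-allFin-suc : ∀ {M} (p : Fin (suc M) → Bool) → all p (allFin (suc M)) ≡ p zero ∧ all (p ∘ suc) (allFin M)
all-allFin-suc {M} p = cong (p zero ∧_) (cong (foldr _∧_ true)
  (trans (map-tabulate suc p) (sym (map-tabulate id (p ∘ suc)))))

noneOutside-update : ∀ {M} (x : Fin M) E → ¬ T (memb x E) → ∀ (ℓ : Fin M → Lab) y →
  noneOutside E ℓ ≡ isNone (ℓ x) ∧ noneOutside (x ∷ E) (update ℓ x y)
noneOutside-update {M} x E x∉E ℓ y = T-ext forth back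
  where
  at : ∀ {j} → T (not (j =ᶠ x)) → update ℓ x y j ≡ ℓ j
  at {j} ne = cong (λ b → if b then y else ℓ j) (¬T⇒≡false (not-elim ne))
  forth : T (noneOutside E ℓ) → T (isNone (ℓ x) ∧ noneOutside (x ∷ E) (update ℓ x y))
  forth h = ∧-intro (∨-elim (all-allFin⁻ _ h x) (⊥-elim ∘ x∉E) id) (all-allFin⁺ _ λ j → pointwise j (T-dec (j =ᶠ x)))
    where
    pointwise : ∀ j → T (j =ᶠ x) ⊎ T (not (j =ᶠ x)) → T (memb j (x ∷ E) ∨ isNone (update ℓ x y j))
    pointwise j (inj₁ e) = ∨-inl (∨-inl e)
    pointwise j (inj₂ ne) = ∨-elim (all-allFin⁻ _ h j) (λ m → ∨-inl (∨-inr {j =ᶠ x} m))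
                              (λ nn → ∨-inr {memb j (x ∷ E)} (subst (T ∘ isNone) (sym (at ne)) nn))
  back : T (isNone (ℓ x) ∧ noneOutside (x ∷ E) (update ℓ x y)) → T (noneOutside E ℓ)
  back h = all-allFin⁺ _ λ j → pointwise j (T-dec (j =ᶠ x))
    where
    pointwise : ∀ j → T (j =ᶠ x) ⊎ T (not (j =ᶠ x)) → T (memb j E ∨ isNone (ℓ j))
    pointwise j (inj₁ e) = ∨-inr {memb j E} (subst (T ∘ isNone ∘ ℓ) (sym (=ᶠ⇒≡ e)) (∧-fst h))
    pointwise j (inj₂ ne) = ∨-elim (all-allFin⁻ _ (∧-snd {isNone (ℓ x)} h) j)
                              (λ m → ∨-elim {j =ᶠ x} m (⊥-elim ∘ not-elim ne) (∨-inl {memb j E}))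
                              (λ nn → ∨-inr {memb j E} (subst (T ∘ isNone) (at ne) nn))

module _ {c ℓ} (D : IntegralDomain c ℓ) where
  open Xi D hiding (zero) renaming (refl to ≈-refl; sym to ≈-sym; trans to ≈-trans)
  open import Relation.Binary.Reasoning.Setoid setoid

  sumOver : List A → (A → Carrier) → Carrier
  sumOver xs F = foldr _+_ 0# (map F xs)

  when : Bool → Carrier → Carrier
  when b v = if b then v else 0#

  Extensional : ∀ {M} → ((Fin M → Lab) → Carrier) → Set _
  Extensional {M} F = ∀ ℓ₁ ℓ₂ → (∀ j → ℓ₁ j ≡ ℓ₂ j) → F ℓ₁ ≈ F ℓ₂

  when-cong : ∀ {a b} {v w} → a ≡ b → v ≈ w → when a v ≈ when b w
  when-cong {true}  refl e = e
  when-cong {false} refl _ = ≈-refl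

  when-congʳ : ∀ b {v w} → (T b → v ≈ w) → when b v ≈ when b w
  when-congʳ true  f = f tt
  when-congʳ false _ = ≈-refl

  when-∧ : ∀ a b v → when (a ∧ b) v ≈ when a (when b v)
  when-∧ true  _ _ = ≈-refl
  when-∧ false _ _ = ≈-refl

  when-* : ∀ b x v → when b (x * v) ≈ x * when b v
  when-* true  _ _ = ≈-refl
  when-* false x _ = ≈-sym (zeroʳ x)

  when-0 : ∀ b → when b 0# ≈ 0#
  when-0 true  = ≈-refl
  when-0 false = ≈-refl

  sumOver-cong : ∀ (xs : List A) {F G : A → Carrier} → (∀ a → F a ≈ G a) → sumOver xs F ≈ sumOver xs G
  sumOver-cong []       _ = ≈-refl
  sumOver-cong (x ∷ xs) e = +-cong (e x) (sumOver-cong xs e)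

  sumOver-0 : ∀ (xs : List A) → sumOver xs (λ _ → 0#) ≈ 0#
  sumOver-0 []       = ≈-refl
  sumOver-0 (x ∷ xs) = ≈-trans (+-identityˡ _) (sumOver-0 xs)

  sumOver-++ : ∀ (xs ys : List A) F → sumOver (xs ++ ys) F ≈ sumOver xs F + sumOver ys F
  sumOver-++ []       ys F = ≈-sym (+-identityˡ _)
  sumOver-++ (x ∷ xs) ys F = ≈-trans (+-cong ≈-refl (sumOver-++ xs ys F)) (≈-sym (+-assoc _ _ _))

  sumOver-concatMap : ∀ (f : A → List B) xs F → sumOver (concatMap f xs) F ≈ sumOver xs (λ a → sumOver (f a) F)
  sumOver-concatMap f []       F = ≈-refl
  sumOver-concatMap f (x ∷ xs) F =
    ≈-trans (sumOver-++ (f x) (concatMap f xs) F) (+-cong ≈-refl (sumOver-concatMap f xs F))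

  sumOver-+ : ∀ (xs : List A) F G → sumOver xs (λ a → F a + G a) ≈ sumOver xs F + sumOver xs G
  sumOver-+ []       F G = ≈-sym (+-identityˡ _)
  sumOver-+ (x ∷ xs) F G = begin
    (F x + G x) + sumOver xs (λ a → F a + G a) ≈⟨ +-cong ≈-refl (sumOver-+ xs F G) ⟩
    (F x + G x) + (sumOver xs F + sumOver xs G) ≈⟨ +-assoc _ _ _ ⟩
    F x + (G x + (sumOver xs F + sumOver xs G)) ≈⟨ +-cong ≈-refl (≈-sym (+-assoc _ _ _)) ⟩
    F x + ((G x + sumOver xs F) + sumOver xs G) ≈⟨ +-cong ≈-refl (+-cong (+-comm _ _) ≈-refl) ⟩
    F x + ((sumOver xs F + G x) + sumOver xs G) ≈⟨ +-cong ≈-refl (+-assoc _ _ _) ⟩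
    F x + (sumOver xs F + (G x + sumOver xs G)) ≈⟨ ≈-sym (+-assoc _ _ _) ⟩
    (F x + sumOver xs F) + (G x + sumOver xs G) ∎

  sumOver-* : ∀ (xs : List A) x F → sumOver xs (λ a → x * F a) ≈ x * sumOver xs F
  sumOver-* []       x F = ≈-sym (zeroʳ x)
  sumOver-* (y ∷ xs) x F = ≈-trans (+-cong ≈-refl (sumOver-* xs x F)) (≈-sym (distribˡ x _ _))

  sumOver-swap : ∀ (xs : List A) (ys : List B) (F : A → B → Carrier) →
    sumOver xs (λ a → sumOver ys (F a)) ≈ sumOver ys (λ b → sumOver xs (λ a → F a b))
  sumOver-swap xs []       F = sumOver-0 xs
  sumOver-swap xs (y ∷ ys) F =
    ≈-trans (sumOver-+ xs (λ a → F a y) (λ a → sumOver ys (F a))) (+-cong ≈-refl (sumOver-swap xs ys F))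

  sumOver-filter : ∀ (p : A → Bool) xs F → sumOver (filterᵇ p xs) F ≈ sumOver xs (λ a → when (p a) (F a))
  sumOver-filter p []       F = ≈-refl
  sumOver-filter p (x ∷ xs) F with p x
  ... | true  = +-cong ≈-refl (sumOver-filter p xs F)
  ... | false = ≈-trans (sumOver-filter p xs F) (≈-sym (+-identityˡ _))

  sumOver-labelings-suc : ∀ M F →
    sumOver (labelings (suc M)) F ≈ sumOver (labelings M) (λ ℓ → sumOver labels (λ x → F (consL x ℓ)))
  sumOver-labelings-suc M F = sumOver-concatMap _ (labelings M) F

  split-by-label : ∀ (a : Lab) (F : Lab → Carrier) → F a ≈ sumOver labels (λ x → when (a =ˡ x) (F x))
  split-by-label none F = ≈-sym (≈-trans (+-cong ≈-refl (≈-trans (+-identityˡ _) (+-identityˡ _))) (+-identityʳ _))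
  split-by-label inA  F = ≈-sym (≈-trans (+-identityˡ _) (≈-trans (+-cong ≈-refl (+-identityˡ _)) (+-identityʳ _)))
  split-by-label inB  F = ≈-sym (≈-trans (+-identityˡ _) (≈-trans (+-identityˡ _) (+-identityʳ _)))

  consL-cong : ∀ {M} {F : (Fin (suc M) → Lab) → Carrier} → Extensional F → ∀ x → Extensional (F ∘ consL x)
  consL-cong F-ext x ℓ₁ ℓ₂ e = F-ext _ _ (λ { zero → refl ; (suc j) → e j })

  sumOver-update : ∀ M (x : Fin M) y (F : (Fin M → Lab) → Carrier) → Extensional F →
    sumOver (labelings M) (λ ℓ → when (isNone (ℓ x)) (F (update ℓ x y))) ≈
    sumOver (labelings M) (λ ℓ → when (ℓ x =ˡ y) (F ℓ))
  sumOver-update (suc M) zero y F F-ext = begin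
    sumOver (labelings (suc M)) (λ ℓ → when (isNone (ℓ zero)) (F (update ℓ zero y)))
      ≈⟨ sumOver-labelings-suc M _ ⟩
    sumOver (labelings M) (λ ℓ → F (update (consL none ℓ) zero y) + (0# + (0# + 0#)))
      ≈⟨ sumOver-cong (labelings M) (λ ℓ → ≈-trans (+-cong (F-ext _ _ (updated ℓ))
                                                      (≈-trans (+-identityˡ _) (+-identityˡ _))) (+-identityʳ _)) ⟩
    sumOver (labelings M) (λ ℓ → F (consL y ℓ))
      ≈⟨ sumOver-cong (labelings M) (λ ℓ → ≈-trans (split-by-label y (λ x → F (consL x ℓ)))
            (sumOver-cong labels (λ x → when-cong {v = F (consL x ℓ)} (=ˡ-sym y x) ≈-refl))) ⟩
    sumOver (labelings M) (λ ℓ → sumOver labels (λ x → when (x =ˡ y) (F (consL x ℓ))))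
      ≈⟨ ≈-sym (sumOver-labelings-suc M _) ⟩
    sumOver (labelings (suc M)) (λ ℓ → when (ℓ zero =ˡ y) (F ℓ)) ∎
    where
    updated : ∀ ℓ j → update (consL none ℓ) zero y j ≡ consL y ℓ j
    updated ℓ zero    = refl
    updated ℓ (suc j) = refl
  sumOver-update (suc M) (suc x) y F F-ext = begin
    sumOver (labelings (suc M)) (λ ℓ → when (isNone (ℓ (suc x))) (F (update ℓ (suc x) y)))
      ≈⟨ sumOver-labelings-suc M _ ⟩
    sumOver (labelings M) (λ ℓ → sumOver labels (λ z → G z ℓ))
      ≈⟨ sumOver-swap (labelings M) labels (λ ℓ z → G z ℓ) ⟩
    sumOver labels (λ z → sumOver (labelings M) (G z))
      ≈⟨ sumOver-cong labels per-label ⟩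
    sumOver labels (λ z → sumOver (labelings M) (G' z))
      ≈⟨ ≈-sym (sumOver-swap (labelings M) labels (λ ℓ z → G' z ℓ)) ⟩
    sumOver (labelings M) (λ ℓ → sumOver labels (λ z → G' z ℓ))
      ≈⟨ ≈-sym (sumOver-labelings-suc M _) ⟩
    sumOver (labelings (suc M)) (λ ℓ → when (ℓ (suc x) =ˡ y) (F ℓ)) ∎
    where
    G G' : Lab → (Fin M → Lab) → Carrier
    G  z ℓ = when (isNone (ℓ x)) (F (update (consL z ℓ) (suc x) y))
    G' z ℓ = when (ℓ x =ˡ y) (F (consL z ℓ))
    updated : ∀ z ℓ j → update (consL z ℓ) (suc x) y j ≡ consL z (update ℓ x y) j
    updated z ℓ zero    = refl
    updated z ℓ (suc j) = cong (λ b → if b then y else ℓ j) (=ᶠ-suc j x)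
    per-label : ∀ z → sumOver (labelings M) (G z) ≈ sumOver (labelings M) (G' z)
    per-label z = ≈-trans (sumOver-cong (labelings M) (λ ℓ → when-cong refl (F-ext _ _ (updated z ℓ))))
                     (sumOver-update M x y (F ∘ consL z) (consL-cong F-ext z))

  sumOver-allNone : ∀ M v → sumOver (labelings M) (λ ℓ → when (noneOutside [] ℓ) v) ≈ v
  sumOver-allNone zero    v = +-identityʳ v
  sumOver-allNone (suc M) v = begin
    sumOver (labelings (suc M)) (λ ℓ → when (noneOutside [] ℓ) v)
      ≈⟨ sumOver-labelings-suc M _ ⟩
    sumOver (labelings M) (λ ℓ → sumOver labels (λ x → when (noneOutside [] (consL x ℓ)) v))
      ≈⟨ sumOver-cong (labelings M) (λ ℓ → ≈-trans (+-cong (when-cong (none-head ℓ) ≈-refl)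
           (≈-trans (+-identityˡ _) (+-identityˡ _))) (+-identityʳ _)) ⟩
    sumOver (labelings M) (λ ℓ → when (noneOutside [] ℓ) v) ≈⟨ sumOver-allNone M v ⟩
    v ∎
    where
    none-head : ∀ (ℓ : Fin M → Lab) → noneOutside [] (consL none ℓ) ≡ noneOutside [] ℓ
    none-head ℓ = all-allFin-suc (λ j → memb j [] ∨ isNone (consL none ℓ j))

  sumOver-restrict : ∀ {M} (E : List (Fin M)) → Unique E → (G : (Fin (length E) → Lab) → Carrier) → Extensional G →
    sumOver (labelings (length E)) G ≈ sumOver (labelings M) (λ ℓ → when (noneOutside E ℓ) (G (ℓ ∘ lookup E)))
  sumOver-restrict {M} [] _ G G-ext = begin
    G (λ ()) + 0#                                                    ≈⟨ +-identityʳ _ ⟩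
    G (λ ())                                                         ≈⟨ ≈-sym (sumOver-allNone M _) ⟩
    sumOver (labelings M) (λ ℓ → when (noneOutside [] ℓ) (G (λ ())))
      ≈⟨ sumOver-cong (labelings M) (λ ℓ → when-cong refl (G-ext _ _ (λ ()))) ⟩
    sumOver (labelings M) (λ ℓ → when (noneOutside [] ℓ) (G (ℓ ∘ lookup []))) ∎
  sumOver-restrict {M} (x ∷ E) (x∉E ∷ E-unique) G G-ext = begin
    sumOver (labelings (suc (length E))) G
      ≈⟨ sumOver-labelings-suc (length E) G ⟩
    sumOver (labelings (length E)) (λ ℓ → sumOver labels (λ y → G (consL y ℓ)))
      ≈⟨ sumOver-swap (labelings (length E)) labels (λ ℓ y → G (consL y ℓ)) ⟩
    sumOver labels (λ y → sumOver (labelings (length E)) (G ∘ consL y))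
      ≈⟨ sumOver-cong labels per-label ⟩
    sumOver labels (λ y → sumOver (labelings M) (T' y))
      ≈⟨ ≈-sym (sumOver-swap (labelings M) labels (λ ℓ y → T' y ℓ)) ⟩
    sumOver (labelings M) (λ ℓ → sumOver labels (λ y → T' y ℓ))
      ≈⟨ sumOver-cong (labelings M) (λ ℓ → ≈-sym (≈-trans
           (when-cong refl (G-ext _ _ (λ { zero → refl ; (suc k) → refl })))
           (split-by-label (ℓ x) (λ a → H a ℓ)))) ⟩
    sumOver (labelings M) (λ ℓ → when (noneOutside (x ∷ E) ℓ) (G (ℓ ∘ lookup (x ∷ E)))) ∎
    where
    H : Lab → (Fin M → Lab) → Carrier
    H y ℓ = when (noneOutside (x ∷ E) ℓ) (G (consL y (ℓ ∘ lookup E)))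

    T' : Lab → (Fin M → Lab) → Carrier
    T' y ℓ = when (ℓ x =ˡ y) (H y ℓ)

    H-ext : ∀ y → Extensional (H y)
    H-ext y ℓ₁ ℓ₂ e = when-cong (all-cong _ _ (allFin M) (λ j → cong (memb j (x ∷ E) ∨_) (cong isNone (e j))))
                                (G-ext _ _ (λ { zero → refl ; (suc k) → e (lookup E k) }))

    update-E : ∀ ℓ y k → update ℓ x y (lookup E k) ≡ ℓ (lookup E k)
    update-E ℓ y k = cong (λ b → if b then y else ℓ (lookup E k)) (¬T⇒≡false (λ e → All.lookup x∉E (∈-lookup k) (sym (=ᶠ⇒≡ e))))

    x-not-memb : ¬ T (memb x E)
    x-not-memb h = All.lookup x∉E (memb⇒∈ E h) refl

    per-label : ∀ y → sumOver (labelings (length E)) (G ∘ consL y) ≈ sumOver (labelings M) (T' y)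
    per-label y = begin
      sumOver (labelings (length E)) (G ∘ consL y)
        ≈⟨ sumOver-restrict E E-unique (G ∘ consL y) (consL-cong G-ext y) ⟩
      sumOver (labelings M) (λ ℓ → when (noneOutside E ℓ) (G (consL y (ℓ ∘ lookup E))))
        ≈⟨ sumOver-cong (labelings M) (λ ℓ → ≈-trans
             (when-cong (noneOutside-update x E x-not-memb ℓ y) (G-ext _ _ (λ { zero → refl ; (suc k) → sym (update-E ℓ y k) })))
             (when-∧ (isNone (ℓ x)) _ _)) ⟩
      sumOver (labelings M) (λ ℓ → when (isNone (ℓ x)) (H y (update ℓ x y)))
        ≈⟨ sumOver-update M x y (H y) (H-ext y) ⟩
      sumOver (labelings M) (T' y) ∎

  sumOver-select : ∀ {m} (p : Fin (suc m) → Bool) → T (not (p zero)) →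
    (F : (Fin (count p) → Lab) → Carrier) → Extensional F →
    sumOver (labelings (count p)) F ≈
    sumOver (labelings m) (λ ℓ → when (noneOutside (selected p) (consL none ℓ)) (F (consL none ℓ ∘ select p)))
  sumOver-select {m} p ¬p0 F F-ext = begin
    sumOver (labelings (count p)) F
      ≈⟨ sumOver-restrict (selected p) (selected-unique p) F F-ext ⟩
    sumOver (labelings (suc m)) (λ ℓ → when (noneOutside (selected p) ℓ) (F (ℓ ∘ select p)))
      ≈⟨ sumOver-labelings-suc m _ ⟩
    sumOver (labelings m) (λ ℓ → sumOver labels (λ x → X x ℓ))
      ≈⟨ sumOver-cong (labelings m) (λ ℓ → ≈-trans (+-cong ≈-refl (≈-trans (+-cong (when-cong (blocked inA ℓ tt) ≈-refl)
            (≈-trans (+-cong (when-cong (blocked inB ℓ tt) ≈-refl) ≈-refl) (+-identityˡ _))) (+-identityˡ _))) (+-identityʳ _)) ⟩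
    sumOver (labelings m) (X none) ∎
    where
    X : Lab → (Fin m → Lab) → Carrier
    X x ℓ = when (noneOutside (selected p) (consL x ℓ)) (F (consL x ℓ ∘ select p))
    blocked : ∀ x ℓ → T (not (isNone x)) → noneOutside (selected p) (consL x ℓ) ≡ false
    blocked x ℓ nn = ¬T⇒≡false λ h → ∨-elim (all-allFin⁻ (λ j → memb j (selected p) ∨ isNone (consL x ℓ j)) h zero)
                       (λ m → not-elim ¬p0 (memb-selected⁻ p zero m)) (not-elim nn)

kAB kB #AB : (G : Hypergraph) → (Fin (m G) → Lab) → ℕ
kAB G ℓ = k (partial G (isAB ∘ ℓ))
kB  G ℓ = k (edgeSection G (isB ∘ ℓ))
#AB G ℓ = count (isAB ∘ ℓ)

vertexDisjoint⁻ : ∀ G (ℓ : Fin (m G) → Lab) → T (vertexDisjoint G ℓ) →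
  ∀ a b → T (isA (ℓ a)) → T (isB (ℓ b)) → ¬ T (meets (inc G a) (inc G b))
vertexDisjoint⁻ G ℓ h a b ia ib mt = not-elim (all-allFin⁻ _ (all-allFin⁻ _ h a) b) (∧-intro ia (∧-intro ib mt))

vertexDisjoint⁺ : ∀ G (ℓ : Fin (m G) → Lab) →
  (∀ a b → T (isA (ℓ a)) → T (isB (ℓ b)) → ¬ T (meets (inc G a) (inc G b))) → T (vertexDisjoint G ℓ)
vertexDisjoint⁺ G ℓ f = all-allFin⁺ _ λ a → all-allFin⁺ _ λ b → not-intro λ h →
  f a b (∧-fst h) (∧-fst (∧-snd {isA (ℓ a)} h)) (∧-snd {isB (ℓ b)} (∧-snd {isA (ℓ a)} h))

-- others, outside and disjoint are the selections made by H ─ zero, H ／ zero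
-- and H † zero, so their counts are the sizes of these hypergraphs.
module FirstEdge {N M : ℕ} (I : Fin (suc M) → Fin N → Bool) where

  H : Hypergraph
  H = hg N (suc M) I

  others : Fin (suc M) → Bool
  others j = not (j =ᶠ zero)

  outside : Fin N → Bool
  outside v = not (I zero v)

  disjoint : Fin (suc M) → Bool
  disjoint j = not (j =ᶠ zero) ∧ not (meets (I j) (I zero))

  others-suc : ∀ r → Σ (Fin M) λ j → select others r ≡ suc j
  others-suc r = view (select others r) (select-sat others r)
    where
    view : ∀ j → T (others j) → Σ (Fin M) λ j' → j ≡ suc j'
    view (suc j) _ = j , refl

  disjoint-suc : ∀ r → Σ (Fin M) λ j → select disjoint r ≡ suc j
  disjoint-suc r = view (select disjoint r) (select-sat disjoint r)
    where
    view : ∀ j → T (disjoint j) → Σ (Fin M) λ j' → j ≡ suc j'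
    view (suc j) _ = j , refl

  deletion-size : m (H ─ zero) ≤ M
  deletion-size = count-≤-pred others tt

  contraction-size : m (H ／ zero) ≤ M
  contraction-size = count-≤-pred others tt

  extraction-size : m (H † zero) ≤ M
  extraction-size = count-≤-pred disjoint tt

  module _ (ne : NonEmptyEdges H) where

    deletion-nonEmpty : NonEmptyEdges (H ─ zero)
    deletion-nonEmpty r = ne (select others r)

    contraction-nonEmpty : NonEmptyEdges (H ／ zero)
    contraction-nonEmpty r with ne (select others r)
    ... | v , v∈ with T-dec (I zero v)
    ... | inj₁ v∈e₀ = zero , T⇒≡true (meets⁺ (I (select others r)) (I zero) v (≡true⇒T v∈) v∈e₀)
    ... | inj₂ v∉e₀ = suc (rank outside v v∉e₀) , trans (cong (I (select others r)) (select-rank outside v v∉e₀)) v∈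

    extraction-nonEmpty : NonEmptyEdges (H † zero)
    extraction-nonEmpty r with ne (select disjoint r)
    ... | v , v∈ = rank outside v v∉e₀ , trans (cong (I (select disjoint r)) (select-rank outside v v∉e₀)) v∈
      where
      v∉e₀ : T (outside v)
      v∉e₀ = not-intro (λ v∈e₀ → not-elim (∧-snd {others (select disjoint r)} (select-sat disjoint r))
                                           (meets⁺ (I (select disjoint r)) (I zero) v (≡true⇒T v∈) v∈e₀))

  module Labelled (c : Fin N) (c∈e₀ : T (I zero c)) (ℓ : Fin M → Lab) where

    with₀ : Lab → Fin (suc M) → Lab
    with₀ x = consL x ℓ

    onOthers : Lab → Fin (count others) → Lab
    onOthers x = with₀ x ∘ select others

    onDisjoint : Lab → Fin (count disjoint) → Lab
    onDisjoint x = with₀ x ∘ select disjoint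

    B-meets₀ : Bool
    B-meets₀ = any (λ j → isB (ℓ j) ∧ meets (I (suc j)) (I zero)) (allFin M)

    B-meets₀⁺ : ∀ j → T (isB (ℓ j)) → T (meets (I (suc j)) (I zero)) → T B-meets₀
    B-meets₀⁺ j b mt = any-allFin⁺ (λ j → isB (ℓ j) ∧ meets (I (suc j)) (I zero)) j (∧-intro b mt)

    B-meets₀⁻ : T B-meets₀ → Σ (Fin M) λ j → T (isB (ℓ j)) × T (meets (I (suc j)) (I zero))
    B-meets₀⁻ h with any-allFin⁻ (λ j → isB (ℓ j) ∧ meets (I (suc j)) (I zero)) h
    ... | j , q = j , ∧-fst q , ∧-snd {isB (ℓ j)} q

    A-avoids₀ : Set
    A-avoids₀ = ∀ j → T (isA (ℓ j)) → T (not (meets (I (suc j)) (I zero)))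

    onOthers-head : ∀ x y r → with₀ x (select others r) ≡ with₀ y (select others r)
    onOthers-head x y r with others-suc r
    ... | j , e = trans (cong (with₀ x) e) (sym (cong (with₀ y) e))

    onDisjoint-head : ∀ x y r → with₀ x (select disjoint r) ≡ with₀ y (select disjoint r)
    onDisjoint-head x y r with disjoint-suc r
    ... | j , e = trans (cong (with₀ x) e) (sym (cong (with₀ y) e))

    module AsDeletion where
      JAB : Fin (suc M) → Bool
      JAB = isAB ∘ with₀ none
      JB : Fin (suc M) → Bool
      JB = isB ∘ with₀ none

      AB⊆others : ∀ j → T (JAB j) → T (others j)
      AB⊆others (suc j) _ = tt
      B⊆others : ∀ j → T (JB j) → T (others j)
      B⊆others (suc j) _ = tt

      kAB≡ : kAB H (with₀ none) ≡ kAB (H ─ zero) (onOthers none)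
      kAB≡ = k-≡ (partial-embedding H JAB)
                 (partial-embeddingʳ H others JAB AB⊆others ∘ᴱ partial-embedding (H ─ zero) (JAB ∘ select others))
                 (λ _ → true) (λ _ _ _ _ → tt) (λ x _ → x , here) (λ x _ → x , here) (λ _ → tt) (λ _ → tt)

      kB≡ : kB H (with₀ none) ≡ kB (H ─ zero) (onOthers none)
      kB≡ = k-≡ (edgeSection-embedding H JB) e' (inSection H JB) (inSection-closed H JB) (edgeSection-cover H JB)
                cover' (select-sat (inSection H JB)) in-Q'
        where
        J' = JB ∘ select others
        P' = inSection (H ─ zero) J'
        e' = partial-embeddingʳ H others JB B⊆others ∘ᴱ edgeSection-embedding (H ─ zero) J'
        cover' : ∀ x → T (inSection H JB x) → Σ (Fin (count P')) λ u → Path H JB x (select P' u)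
        cover' x q with inSection⁻ H JB x q
        ... | j , bj , ij = rank P' x px , subst (Path H JB x) (sym (select-rank P' x px)) here
          where
          r = rank others j (B⊆others j bj)
          er = select-rank others j (B⊆others j bj)
          px : T (P' x)
          px = inSection⁺ (H ─ zero) J' r x (subst (T ∘ JB) (sym er) bj) (subst (λ z → T (I z x)) (sym er) ij)
        in-Q' : ∀ u → T (inSection H JB (select P' u))
        in-Q' u with inSection⁻ (H ─ zero) J' (select P' u) (select-sat P' u)
        ... | r , q , a = inSection⁺ H JB (select others r) _ q a

      #AB≡ : #AB H (with₀ none) ≡ #AB (H ─ zero) (onOthers none)
      #AB≡ = count-restrict others (isAB ∘ with₀ none) AB⊆others

    module AsContraction (x : Lab) (x∈AB : T (isAB x)) where
      JAB : Fin (suc M) → Bool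
      JAB = isAB ∘ with₀ x
      module Con = Contraction H zero c c∈e₀ JAB x∈AB

      kAB≡ : kAB H (with₀ x) ≡ kAB (H ／ zero) (onOthers x)
      kAB≡ = k-≡ (partial-embedding H JAB)
                 (Con.contraction-embedding ∘ᴱ partial-embedding (H ／ zero) (JAB ∘ select others))
                 (λ _ → true) (λ _ _ _ _ → tt) (λ y _ → y , here) (λ y _ → Con.project y , Con.lift-project y)
                 (λ _ → tt) (λ _ → tt)

      #AB≡ : #AB H (with₀ x) ≡ suc (#AB (H ／ zero) (onOthers x))
      #AB≡ = trans (count-split (isAB ∘ with₀ x) (_=ᶠ zero))
                   (cong₂ _+ℕ_ only-e₀ (trans (count-restrict others rest (λ j q → ∧-snd {isAB (with₀ x j)} q))
                     (count-cong _ _ (λ r → trans (cong (isAB (with₀ x (select others r)) ∧_)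
                                                     (T⇒≡true (select-sat others r))) (∧-identityʳ _)))))
        where
        rest : Fin (suc M) → Bool
        rest j = isAB (with₀ x j) ∧ not (j =ᶠ zero)
        only-e₀ : count (λ j → isAB (with₀ x j) ∧ (j =ᶠ zero)) ≡ 1
        only-e₀ = count≡1 _ zero (∧-intro x∈AB (=ᶠ-refl {suc M} zero))
          (λ y z qy qz → trans (=ᶠ⇒≡ (∧-snd {isAB (with₀ x y)} qy)) (sym (=ᶠ⇒≡ (∧-snd {isAB (with₀ x z)} qz))))

    module SectionAsContractionB (B-meets : T B-meets₀) where
      JB : Fin (suc M) → Bool
      JB = isB ∘ with₀ inB
      module Con = Contraction H zero c c∈e₀ JB tt
      J' : Fin (count others) → Bool
      J' = JB ∘ select others
      P' : Fin (suc (count outside)) → Bool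
      P' = inSection (H ／ zero) J'

      project-in : ∀ y → T (inSection H JB y) → T (P' (Con.project y))
      project-in y q with inSection⁻ H JB y q
      project-in y q | zero , bj , ij with B-meets₀⁻ B-meets
      ... | j , b , mt = subst (T ∘ P') (sym (Con.project-in y ij))
            (inSection⁺ (H ／ zero) J' r zero (subst (T ∘ JB) (sym er) b)
              (subst (λ z → T (meets (I z) (I zero))) (sym er) mt))
        where
        r = rank others (suc j) tt
        er = select-rank others (suc j) tt
      project-in y q | suc j , bj , ij = inSection⁺ (H ／ zero) J' r (Con.project y) (subst (T ∘ JB) (sym er) bj)
            (Con.inc-project r y (subst (λ z → T (I z y)) (sym er) ij))
        where
        r = rank others (suc j) tt
        er = select-rank others (suc j) tt

      lift-in : ∀ w → T (P' w) → T (inSection H JB (Con.lift w))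
      lift-in zero _ = inSection⁺ H JB zero c tt c∈e₀
      lift-in (suc y) q with inSection⁻ (H ／ zero) J' (suc y) q
      ... | r , b , a = inSection⁺ H JB (select others r) _ b a

      kB≡ : kB H (with₀ inB) ≡ kB (H ／ zero) (onOthers inB)
      kB≡ = k-≡ (edgeSection-embedding H JB) (Con.contraction-embedding ∘ᴱ edgeSection-embedding (H ／ zero) J')
              (inSection H JB) (inSection-closed H JB) (edgeSection-cover H JB) cover'
              (select-sat (inSection H JB)) (λ u → lift-in (select P' u) (select-sat P' u))
        where
        cover' : ∀ y → T (inSection H JB y) → Σ (Fin (count P')) λ u → Path H JB y (Con.lift (select P' u))
        cover' y q = rank P' (Con.project y) (project-in y q) ,
                     subst (λ z → Path H JB y (Con.lift z)) (sym (select-rank P' _ (project-in y q))) (Con.lift-project y)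

    -- The B-section for e₀ labelled A avoids e₀, so it embeds into the
    -- connectivity for e₀ labelled B, which the contraction respects.
    module SectionAsContractionA (¬B-meets : T (not B-meets₀)) where
      JA : Fin (suc M) → Bool
      JA = isB ∘ with₀ inA
      J⁺ : Fin (suc M) → Bool
      J⁺ = isB ∘ with₀ inB
      module Con = Contraction H zero c c∈e₀ J⁺ tt
      J' : Fin (count others) → Bool
      J' = J⁺ ∘ select others
      P' : Fin (suc (count outside)) → Bool
      P' = inSection (H ／ zero) J'
      PA : Fin N → Bool
      PA = inSection H JA

      misses₀ : ∀ y → T (PA y) → ¬ T (I zero y)
      misses₀ y q y∈e₀ with inSection⁻ H JA y q
      ... | suc j , bj , ij = not-elim ¬B-meets (B-meets₀⁺ j bj (meets⁺ (I (suc j)) (I zero) y ij y∈e₀))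

      e : PathEmbedding (edgeSection H JA) H (λ _ → true) J⁺
      e = sub-embedding H PA JA (λ _ → true) J⁺ A⇒B inside
        where
        A⇒B : ∀ r → T true → T (J⁺ (select JA r))
        A⇒B r _ = go (select JA r) (select-sat JA r)
          where
          go : ∀ j → T (JA j) → T (J⁺ j)
          go (suc j) q = q
        inside : ∀ j w → T (J⁺ j) → T (PA w) → T (I j w) →
                 (∀ v → T (I j v) → T (PA v)) × Σ (Fin (count JA)) λ r → select JA r ≡ j × T true
        inside zero w q pw iw = ⊥-elim (misses₀ w pw iw)
        inside (suc j) w q pw iw = (λ v iv → inSection⁺ H JA (suc j) v q iv) , rank JA (suc j) q , select-rank JA (suc j) q , tt

      PA-closed : ∀ y z → T (PA y) → Path H J⁺ y z → T (PA z)
      PA-closed y z q here = q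
      PA-closed y z q (via {w} zero p _ a b) = ⊥-elim (misses₀ w (PA-closed y w q p) a)
      PA-closed y z q (via (suc j) p bj a b) = inSection⁺ H JA (suc j) z bj b

      kB≡ : kB H (with₀ inA) ≡ kB (H ／ zero) (onOthers inA)
      kB≡ = trans kB≡⁺ (cong k (edgeSection-cong (H ／ zero) J' (isB ∘ onOthers inA) (λ r → cong isB (onOthers-head inB inA r))))
        where
        project-in : ∀ y → T (PA y) → T (P' (Con.project y))
        project-in y q with inSection⁻ H JA y q
        ... | suc j , bj , ij = inSection⁺ (H ／ zero) J' r (Con.project y) (subst (T ∘ J⁺) (sym er) bj)
              (Con.inc-project r y (subst (λ z → T (I z y)) (sym er) ij))
          where
          r = rank others (suc j) tt
          er = select-rank others (suc j) tt
        cover' : ∀ y → T (PA y) → Σ (Fin (count P')) λ u → Path H J⁺ y (Con.lift (select P' u))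
        cover' y q = rank P' (Con.project y) (project-in y q) ,
                     subst (λ z → Path H J⁺ y (Con.lift z)) (sym (select-rank P' _ (project-in y q))) (Con.lift-project y)
        lift-in : ∀ w → T (P' w) → T (PA (Con.lift w))
        lift-in zero q with inSection⁻ (H ／ zero) J' zero q
        ... | r , b , a with others-suc r
        ... | j , er = ⊥-elim (not-elim ¬B-meets (B-meets₀⁺ j (subst (T ∘ J⁺) er b) (subst (λ z → T (meets (I z) (I zero))) er a)))
        lift-in (suc y) q with inSection⁻ (H ／ zero) J' (suc y) q
        ... | r , b , a with others-suc r
        ... | j , er = inSection⁺ H JA (select others r) _ (subst (T ∘ JA) (sym er) (subst (T ∘ J⁺) er b)) a
        kB≡⁺ : k (edgeSection H JA) ≡ k (edgeSection (H ／ zero) J')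
        kB≡⁺ = k-≡ e (Con.contraction-embedding ∘ᴱ edgeSection-embedding (H ／ zero) J') PA PA-closed
                 (λ y q → rank PA y q , subst (Path H J⁺ y) (sym (select-rank PA y q)) here) cover' (select-sat PA)
                 (λ u → lift-in (select P' u) (select-sat P' u))

    -- The component of e₀ splits off; the rest is seen in H † e₀.
    module AsExtraction (¬B-meets : T (not B-meets₀)) (A-avoids : A-avoids₀) where
      JAB : Fin (suc M) → Bool
      JAB = isAB ∘ with₀ inB
      JB : Fin (suc M) → Bool
      JB = isB ∘ with₀ inB

      AB-apart : ∀ j → T (JAB j) → ¬ j ≡ zero → T (not (meets (I j) (I zero)))
      AB-apart zero q ne = ⊥-elim (ne refl)
      AB-apart (suc j) q ne with ℓ j in eq
      ... | inA = A-avoids j (subst (T ∘ isA) (sym eq) tt)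
      ... | inB = not-intro (λ mt → not-elim ¬B-meets (B-meets₀⁺ j (subst (T ∘ isB) (sym eq) tt) mt))

      B-apart : ∀ j → T (JB j) → ¬ j ≡ zero → T (not (meets (I j) (I zero)))
      B-apart j q = AB-apart j (B⇒AB (with₀ inB j) q)
        where
        B⇒AB : ∀ a → T (isB a) → T (isAB a)
        B⇒AB inB _ = tt

      extraction-embedding : ∀ (J : Fin (suc M) → Bool) → (∀ j → T (J j) → ¬ j ≡ zero → T (not (meets (I j) (I zero)))) →
                             PathEmbedding (H † zero) H (J ∘ select disjoint) J
      extraction-embedding J apart = sub-embedding H outside disjoint (J ∘ select disjoint) J (λ _ q → q) inside
        where
        inside : ∀ j w → T (J j) → T (outside w) → T (I j w) →
                 (∀ v → T (I j v) → T (outside v)) × Σ (Fin (count disjoint)) λ r → select disjoint r ≡ j × T (J (select disjoint r))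
        inside zero w q pw iw = ⊥-elim (not-elim pw iw)
        inside (suc j) w q pw iw =
          (λ v iv → not-intro (λ iv₀ → not-elim apart-j (meets⁺ (I (suc j)) (I zero) v iv iv₀))) ,
          rank disjoint (suc j) apart-j , select-rank disjoint (suc j) apart-j ,
          subst (T ∘ J) (sym (select-rank disjoint (suc j) apart-j)) q
          where
          apart-j = apart (suc j) q (λ ())

      one-root-in-e₀ : ∀ (J : Fin (suc M) → Bool) → T (J zero) →
        (∀ j → T (J j) → ¬ j ≡ zero → T (not (meets (I j) (I zero)))) →
        ∀ (G : Hypergraph) (e : PathEmbedding G H (λ _ → true) J) (u₀ : Fin (n G)) → T (I zero (ι e u₀)) →
        count (λ v → (isRoot G v ∧ true) ∧ I zero (ι e v)) ≡ 1
      one-root-in-e₀ J J₀ apart G e u₀ u₀∈e₀ =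
        count≡1 _ r (∧-intro (∧-intro r-root tt) r∈e₀)
          (λ y z qy qz → root-unique G y z (∧-fst (∧-fst {isRoot G y ∧ true} qy)) (∧-fst (∧-fst {isRoot G z ∧ true} qz))
             (from e (Path-edge zero J₀ (∧-snd {isRoot G y ∧ true} qy) (∧-snd {isRoot G z ∧ true} qz))))
        where
        r = proj₁ (root-exists G u₀)
        r-root = proj₁ (proj₂ (root-exists G u₀))
        r∈e₀ : T (I zero (ι e r))
        r∈e₀ with T-dec (I zero (ι e r))
        ... | inj₁ h = h
        ... | inj₂ h = ⊥-elim (not-elim (avoid H zero J apart (to e (proj₂ (proj₂ (root-exists G u₀)))) h) u₀∈e₀)

      kAB≡ : kAB H (with₀ inB) ≡ suc (kAB (H † zero) (onDisjoint inB))
      kAB≡ = trans (sym (rootsIn-all G (λ _ → true) (λ _ → tt)))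
               (trans (count-split (λ v → isRoot G v ∧ true) (I zero))
                 (cong₂ _+ℕ_ (one-root-in-e₀ JAB tt AB-apart G e c c∈e₀)
                   (trans (count-cong _ _ (λ v → cong (_∧ not (I zero v)) (∧-identityʳ (isRoot G v))))
                     (trans (rootsIn-≡ e e' outside (λ x y q p → avoid H zero JAB AB-apart p q) (λ y q → y , here)
                              (λ y q → rank outside y q , subst (Path H JAB y) (sym (select-rank outside y q)) here))
                            (rootsIn-all G' (outside ∘ select outside) (select-sat outside))))))
        where
        G = partial H JAB
        G' = partial (H † zero) (JAB ∘ select disjoint)
        e = partial-embedding H JAB
        e' = extraction-embedding JAB AB-apart ∘ᴱ partial-embedding (H † zero) (JAB ∘ select disjoint)

      #AB≡ : #AB H (with₀ inB) ≡ suc (#AB (H † zero) (onDisjoint inB))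
      #AB≡ = trans (count-split (isAB ∘ with₀ inB) (_=ᶠ zero))
               (cong₂ _+ℕ_ only-e₀ (trans (count-restrict disjoint rest rest⊆disjoint)
                 (count-cong _ _ (λ r → trans (cong (isAB (with₀ inB (select disjoint r)) ∧_)
                                   (T⇒≡true (∧-fst {not (select disjoint r =ᶠ zero)} (select-sat disjoint r)))) (∧-identityʳ _)))))
        where
        rest : Fin (suc M) → Bool
        rest j = isAB (with₀ inB j) ∧ not (j =ᶠ zero)
        rest⊆disjoint : ∀ j → T (rest j) → T (disjoint j)
        rest⊆disjoint j q = ∧-intro {not (j =ᶠ zero)} (∧-snd {isAB (with₀ inB j)} q)
          (AB-apart j (∧-fst q) (not-=ᶠ⇒≢ (∧-snd {isAB (with₀ inB j)} q)))
        only-e₀ : count (λ j → isAB (with₀ inB j) ∧ (j =ᶠ zero)) ≡ 1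
        only-e₀ = count≡1 (λ j → isAB (with₀ inB j) ∧ (j =ᶠ zero)) zero (∧-intro {true} tt (=ᶠ-refl {suc M} zero))
          (λ y z qy qz → trans (=ᶠ⇒≡ (∧-snd {isAB (with₀ inB y)} qy)) (sym (=ᶠ⇒≡ (∧-snd {isAB (with₀ inB z)} qz))))

      kB≡ : kB H (with₀ inB) ≡ suc (kB (H † zero) (onDisjoint inB))
      kB≡ = trans (sym (rootsIn-all G (λ _ → true) (λ _ → tt)))
              (trans (count-split (λ v → isRoot G v ∧ true) (λ v → I zero (select PH v)))
                (cong₂ _+ℕ_ one-root-in-e₀'
                  (trans (count-cong _ _ (λ v → trans (cong (_∧ not (I zero (select PH v))) (∧-identityʳ (isRoot G v)))
                                               (cong (isRoot G v ∧_) (sym (cong (_∧ not (I zero (select PH v))) (T⇒≡true (select-sat PH v)))))))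
                    (trans (rootsIn-≡ e e' Q Q-closed cover cover') (rootsIn-all G' (Q ∘ ι e') in-Q')))))
        where
        PH = inSection H JB
        G = edgeSection H JB
        J' = JB ∘ select disjoint
        G' = edgeSection (H † zero) J'
        P' = inSection (H † zero) J'
        e = edgeSection-embedding H JB
        e' = extraction-embedding JB B-apart ∘ᴱ edgeSection-embedding (H † zero) J'
        Q : Fin N → Bool
        Q x = PH x ∧ outside x
        Q-closed : ∀ x y → T (Q x) → Path H JB x y → T (Q y)
        Q-closed x y q p = ∧-intro (inSection-closed H JB x y (∧-fst q) p) (avoid H zero JB B-apart p (∧-snd {PH x} q))
        cover : ∀ x → T (Q x) → Σ (Fin (count PH)) λ u → Path H JB x (select PH u)
        cover x q = edgeSection-cover H JB x (∧-fst q)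
        cover' : ∀ x → T (Q x) → Σ (Fin (count P')) λ u → Path H JB x (select outside (select P' u))
        cover' x q with inSection⁻ H JB x (∧-fst q)
        ... | zero , bj , ij = ⊥-elim (not-elim (∧-snd {PH x} q) ij)
        ... | suc j , bj , ij = rank P' y py ,
              subst (Path H JB x) (sym (trans (cong (select outside) (select-rank P' y py)) (select-rank outside x x∉e₀))) here
          where
          x∉e₀ = ∧-snd {PH x} q
          apart-j = B-apart (suc j) bj (λ ())
          r = rank disjoint (suc j) apart-j
          er = select-rank disjoint (suc j) apart-j
          y = rank outside x x∉e₀
          py : T (P' y)
          py = inSection⁺ (H † zero) J' r y (subst (T ∘ JB) (sym er) bj)
                 (subst₂ (λ a b → T (I a b)) (sym er) (sym (select-rank outside x x∉e₀)) ij)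
        in-Q' : ∀ u → T (Q (select outside (select P' u)))
        in-Q' u with inSection⁻ (H † zero) J' (select P' u) (select-sat P' u)
        ... | r , b , a = ∧-intro (inSection⁺ H JB (select disjoint r) _ b a) (select-sat outside (select P' u))
        c∈PH = inSection⁺ H JB zero c tt c∈e₀
        one-root-in-e₀' : count (λ v → (isRoot G v ∧ true) ∧ I zero (select PH v)) ≡ 1
        one-root-in-e₀' = one-root-in-e₀ JB tt B-apart G e (rank PH c c∈PH)
          (subst (T ∘ I zero) (sym (select-rank PH c c∈PH)) c∈e₀)

    relabel-select : ∀ {x} (f : Lab → Bool) (p : Fin (suc M) → Bool) j q →
                     T (f (with₀ x j)) → T (f (with₀ x (select p (rank p j q))))
    relabel-select {x} f p j q h = subst (λ z → T (f (with₀ x z))) (sym (select-rank p j q)) h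

    inc-contraction : ∀ j w → T (I j w) → (w∉e₀ : T (outside w)) → (q : T (others j)) →
                      T (inc (H ／ zero) (rank others j q) (suc (rank outside w w∉e₀)))
    inc-contraction j w p w∉e₀ q = subst₂ (λ a b → T (I a b)) (sym (select-rank others j q)) (sym (select-rank outside w w∉e₀)) p

    inc-contraction-new : ∀ j → T (meets (I j) (I zero)) → (q : T (others j)) →
                          T (inc (H ／ zero) (rank others j q) zero)
    inc-contraction-new j mt q = subst (λ a → T (meets (I a) (I zero))) (sym (select-rank others j q)) mt

    inc-extraction : ∀ j w → T (I j w) → (w∉e₀ : T (outside w)) → (q : T (disjoint j)) →
                     T (inc (H † zero) (rank disjoint j q) (rank outside w w∉e₀))
    inc-extraction j w p w∉e₀ q = subst₂ (λ a b → T (I a b)) (sym (select-rank disjoint j q)) (sym (select-rank outside w w∉e₀)) p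

    meets-contraction : ∀ a b w → T (inc (H ／ zero) a w) → T (inc (H ／ zero) b w) → T (meets (inc (H ／ zero) a) (inc (H ／ zero) b))
    meets-contraction a b = meets⁺ (inc (H ／ zero) a) (inc (H ／ zero) b)

    vd-deletion : vertexDisjoint H (with₀ none) ≡ vertexDisjoint (H ─ zero) (onOthers none)
    vd-deletion = T-ext forth back
      where
      forth : T (vertexDisjoint H (with₀ none)) → T (vertexDisjoint (H ─ zero) (onOthers none))
      forth h = vertexDisjoint⁺ (H ─ zero) (onOthers none) λ a b ia ib mt →
        vertexDisjoint⁻ H (with₀ none) h (select others a) (select others b) ia ib mt
      back : T (vertexDisjoint (H ─ zero) (onOthers none)) → T (vertexDisjoint H (with₀ none))
      back h = vertexDisjoint⁺ H (with₀ none) λ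
        { zero b () ib mt
        ; (suc a) zero ia () mt
        ; (suc a) (suc b) ia ib mt → vertexDisjoint⁻ (H ─ zero) (onOthers none) h (rank others (suc a) tt) (rank others (suc b) tt)
            (relabel-select isA others (suc a) tt ia) (relabel-select isB others (suc b) tt ib)
            (subst₂ (λ u v → T (meets (I u) (I v))) (sym (select-rank others (suc a) tt)) (sym (select-rank others (suc b) tt)) mt) }

    vd-A-blocked : T B-meets₀ → vertexDisjoint H (with₀ inA) ≡ false
    vd-A-blocked B-meets with B-meets₀⁻ B-meets
    ... | j , ib , mt = ¬T⇒≡false (λ h → vertexDisjoint⁻ H (with₀ inA) h zero (suc j) tt ib (meets-sym (I (suc j)) (I zero) mt))

    vd-A-contraction : T (not B-meets₀) → vertexDisjoint H (with₀ inA) ≡ vertexDisjoint (H ／ zero) (onOthers inA)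
    vd-A-contraction ¬B-meets = T-ext forth back
      where
      forth : T (vertexDisjoint H (with₀ inA)) → T (vertexDisjoint (H ／ zero) (onOthers inA))
      forth h = vertexDisjoint⁺ (H ／ zero) (onOthers inA) λ a b ia ib mt → go a b ia ib (meets⁻ (inc (H ／ zero) a) (inc (H ／ zero) b) mt)
        where
        go : ∀ a b → T (isA (onOthers inA a)) → T (isB (onOthers inA b)) →
             (Σ _ λ w → T (inc (H ／ zero) a w) × T (inc (H ／ zero) b w)) → ⊥
        go a b ia ib (zero , p , q) with others-suc b
        ... | j , e = not-elim ¬B-meets (B-meets₀⁺ j (subst (λ z → T (isB (with₀ inA z))) e ib) (subst (λ z → T (meets (I z) (I zero))) e q))
        go a b ia ib (suc y , p , q) = vertexDisjoint⁻ H (with₀ inA) h (select others a) (select others b) ia ib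
                                         (meets⁺ (I (select others a)) (I (select others b)) (select outside y) p q)
      back : T (vertexDisjoint (H ／ zero) (onOthers inA)) → T (vertexDisjoint H (with₀ inA))
      back h = vertexDisjoint⁺ H (with₀ inA) λ a b ia ib mt → go a b ia ib (meets⁻ (I a) (I b) mt)
        where
        go : ∀ a b → T (isA (with₀ inA a)) → T (isB (with₀ inA b)) → (Σ _ λ w → T (I a w) × T (I b w)) → ⊥
        go a zero ia () _
        go a (suc b) ia ib (w , p , q) with T-dec (I zero w)
        ... | inj₁ w∈e₀ = not-elim ¬B-meets (B-meets₀⁺ b ib (meets⁺ (I (suc b)) (I zero) w q w∈e₀))
        go zero (suc b) ia ib (w , p , q) | inj₂ w∉e₀ = not-elim w∉e₀ p
        go (suc a) (suc b) ia ib (w , p , q) | inj₂ w∉e₀ =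
          vertexDisjoint⁻ (H ／ zero) (onOthers inA) h (rank others (suc a) tt) (rank others (suc b) tt)
            (relabel-select isA others (suc a) tt ia) (relabel-select isB others (suc b) tt ib)
            (meets-contraction _ _ (suc (rank outside w w∉e₀)) (inc-contraction (suc a) w p w∉e₀ tt) (inc-contraction (suc b) w q w∉e₀ tt))

    vd-B-contraction : T B-meets₀ → vertexDisjoint H (with₀ inB) ≡ vertexDisjoint (H ／ zero) (onOthers inB)
    vd-B-contraction B-meets = T-ext forth back
      where
      forth : T (vertexDisjoint H (with₀ inB)) → T (vertexDisjoint (H ／ zero) (onOthers inB))
      forth h = vertexDisjoint⁺ (H ／ zero) (onOthers inB) λ a b ia ib mt → go a b ia ib (meets⁻ (inc (H ／ zero) a) (inc (H ／ zero) b) mt)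
        where
        go : ∀ a b → T (isA (onOthers inB a)) → T (isB (onOthers inB b)) →
             (Σ _ λ w → T (inc (H ／ zero) a w) × T (inc (H ／ zero) b w)) → ⊥
        go a b ia ib (zero , p , q) = vertexDisjoint⁻ H (with₀ inB) h (select others a) zero ia tt p
        go a b ia ib (suc y , p , q) = vertexDisjoint⁻ H (with₀ inB) h (select others a) (select others b) ia ib
                                         (meets⁺ (I (select others a)) (I (select others b)) (select outside y) p q)
      back : T (vertexDisjoint (H ／ zero) (onOthers inB)) → T (vertexDisjoint H (with₀ inB))
      back h = vertexDisjoint⁺ H (with₀ inB) λ a b ia ib mt → go a b ia ib (meets⁻ (I a) (I b) mt)
        where
        ra = λ a → rank others (suc a) tt
        refute : ∀ a b w → T (isA (ℓ a)) → T (isB (with₀ inB (suc b))) →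
                 T (inc (H ／ zero) (ra a) w) → T (inc (H ／ zero) (ra b) w) → ⊥
        refute a b w ia ib p q = vertexDisjoint⁻ (H ／ zero) (onOthers inB) h (ra a) (ra b)
          (relabel-select isA others (suc a) tt ia) (relabel-select isB others (suc b) tt ib) (meets-contraction _ _ w p q)
        go : ∀ a b → T (isA (with₀ inB a)) → T (isB (with₀ inB b)) → (Σ _ λ w → T (I a w) × T (I b w)) → ⊥
        go zero b () ib _
        go (suc a) zero ia ib (w , p , q) with B-meets₀⁻ B-meets
        ... | j , bj , mtj = refute a j zero ia bj (inc-contraction-new (suc a) (meets⁺ (I (suc a)) (I zero) w p q) tt)
                                                   (inc-contraction-new (suc j) mtj tt)
        go (suc a) (suc b) ia ib (w , p , q) with T-dec (I zero w)
        ... | inj₁ w∈e₀ = refute a b zero ia ib (inc-contraction-new (suc a) (meets⁺ (I (suc a)) (I zero) w p w∈e₀) tt)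
                                                (inc-contraction-new (suc b) (meets⁺ (I (suc b)) (I zero) w q w∈e₀) tt)
        ... | inj₂ w∉e₀ = refute a b (suc (rank outside w w∉e₀)) ia ib (inc-contraction (suc a) w p w∉e₀ tt)
                                                                      (inc-contraction (suc b) w q w∉e₀ tt)

    A-avoids-if-vd : T (vertexDisjoint H (with₀ inB)) → A-avoids₀
    A-avoids-if-vd h j ia = not-intro (λ mt → vertexDisjoint⁻ H (with₀ inB) h (suc j) zero ia tt mt)

    meeting₀-none : Bool
    meeting₀-none = noneOutside (selected disjoint) (with₀ none)

    vd-B-extraction⇒ : T (not B-meets₀) → T (vertexDisjoint H (with₀ inB)) →
                       T (meeting₀-none ∧ vertexDisjoint (H † zero) (onDisjoint inB))
    vd-B-extraction⇒ ¬B-meets h = ∧-intro (all-allFin⁺ _ none-at) vd†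
      where
      none-at : ∀ j → T (memb j (selected disjoint) ∨ isNone (with₀ none j))
      none-at zero = ∨-inr {memb zero (selected disjoint)} tt
      none-at (suc j) with T-dec (meets (I (suc j)) (I zero))
      ... | inj₂ apart = ∨-inl (memb-selected⁺ disjoint (suc j) apart)
      ... | inj₁ mt with ℓ j in eq
      ... | none = ∨-inr {memb (suc j) (selected disjoint)} tt
      ... | inA = ⊥-elim (vertexDisjoint⁻ H (with₀ inB) h (suc j) zero (subst (T ∘ isA) (sym eq) tt) tt mt)
      ... | inB = ⊥-elim (not-elim ¬B-meets (B-meets₀⁺ j (subst (T ∘ isB) (sym eq) tt) mt))
      vd† : T (vertexDisjoint (H † zero) (onDisjoint inB))
      vd† = vertexDisjoint⁺ (H † zero) (onDisjoint inB) λ a b ia ib mt →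
        let (y , p , q) = meets⁻ (inc (H † zero) a) (inc (H † zero) b) mt in
        vertexDisjoint⁻ H (with₀ inB) h (select disjoint a) (select disjoint b) ia ib
          (meets⁺ (I (select disjoint a)) (I (select disjoint b)) (select outside y) p q)

    vd-B-extraction⇐ : T (meeting₀-none ∧ vertexDisjoint (H † zero) (onDisjoint inB)) → T (vertexDisjoint H (with₀ inB))
    vd-B-extraction⇐ h = vertexDisjoint⁺ H (with₀ inB) λ a b ia ib mt → go a b ia ib (meets⁻ (I a) (I b) mt)
      where
      vd† = ∧-snd {meeting₀-none} h
      labelled⇒disjoint : ∀ j → ¬ T (isNone (with₀ none j)) → T (disjoint j)
      labelled⇒disjoint zero f = ⊥-elim (f tt)
      labelled⇒disjoint (suc j) f =
        ∨-elim (all-allFin⁻ (λ j → memb j (selected disjoint) ∨ isNone (with₀ none j)) (∧-fst h) (suc j))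
               (memb-selected⁻ disjoint (suc j)) (⊥-elim ∘ f)
      A-not-none : ∀ x → T (isA x) → ¬ T (isNone x)
      A-not-none inA _ ()
      B-not-none : ∀ x → T (isB x) → ¬ T (isNone x)
      B-not-none inB _ ()
      go : ∀ a b → T (isA (with₀ inB a)) → T (isB (with₀ inB b)) → (Σ _ λ w → T (I a w) × T (I b w)) → ⊥
      go zero b () ib _
      go (suc a) b ia ib (w , p , q) = go-b b ib q
        where
        da : T (disjoint (suc a))
        da = labelled⇒disjoint (suc a) (A-not-none (ℓ a) ia)
        w∉e₀ : T (outside w)
        w∉e₀ = not-intro (λ w∈e₀ → not-elim (∧-snd {not (suc a =ᶠ zero)} da) (meets⁺ (I (suc a)) (I zero) w p w∈e₀))
        go-b : ∀ b → T (isB (with₀ inB b)) → T (I b w) → ⊥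
        go-b zero ib q = not-elim w∉e₀ q
        go-b (suc b) ib q = vertexDisjoint⁻ (H † zero) (onDisjoint inB) vd† (rank disjoint (suc a) da) (rank disjoint (suc b) db)
            (relabel-select isA disjoint (suc a) da ia) (relabel-select isB disjoint (suc b) db ib)
            (meets⁺ (inc (H † zero) (rank disjoint (suc a) da)) (inc (H † zero) (rank disjoint (suc b) db)) (rank outside w w∉e₀)
               (inc-extraction (suc a) w p w∉e₀ da) (inc-extraction (suc b) w q w∉e₀ db))
          where
          db = labelled⇒disjoint (suc b) (B-not-none (ℓ b) ib)

    vd-B-extraction : T (not B-meets₀) →
      vertexDisjoint H (with₀ inB) ≡ meeting₀-none ∧ vertexDisjoint (H † zero) (onDisjoint inB)
    vd-B-extraction ¬B-meets = T-ext (vd-B-extraction⇒ ¬B-meets) vd-B-extraction⇐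

module _ {c ℓ} (D : IntegralDomain c ℓ) where
  open Xi D hiding (zero) renaming (refl to ≈-refl; sym to ≈-sym; trans to ≈-trans)
  open import Relation.Binary.Reasoning.Setoid setoid

  -- ξ and β^m ξ are pair sums whose weight depends only on the statistics
  -- kAB, #AB and kB of a labeling.
  Weight : Set _
  Weight = ℕ → ℕ → ℕ → Carrier

  weight : Weight → (G : Hypergraph) → (Fin (m G) → Lab) → Carrier
  weight w G ℓ = w (kAB G ℓ) (#AB G ℓ) (kB G ℓ)

  term : Weight → (G : Hypergraph) → (Fin (m G) → Lab) → Carrier
  term w G ℓ = when D (vertexDisjoint G ℓ) (weight w G ℓ)

  pairSum : Weight → Hypergraph → Carrier
  pairSum w G = sumOver D (labelings (m G)) (term w G)

  shiftSize shiftAll : Weight → Weight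
  shiftSize w a b c = w a (suc b) c
  shiftAll  w a b c = w (suc a) (suc b) (suc c)

  weight-cong : ∀ (w : Weight) {a a' b b' c c'} → a ≡ a' → b ≡ b' → c ≡ c' → w a b c ≈ w a' b' c'
  weight-cong w refl refl refl = ≈-refl

  term-extensional : ∀ w G → Extensional D (term w G)
  term-extensional w G ℓ₁ ℓ₂ e = when-cong D
    (all-cong _ _ (allFin (m G)) (λ a → all-cong _ _ (allFin (m G)) (λ b →
       cong₂ (λ u v → not (isA u ∧ isB v ∧ meets (inc G a) (inc G b))) (e a) (e b))))
    (weight-cong w (cong k (partial-cong G _ _ (λ j → cong isAB (e j))))
                   (count-cong _ _ (λ j → cong isAB (e j)))
                   (cong k (edgeSection-cong G _ _ (λ j → cong isB (e j)))))

  module Recurrence {N M : ℕ} (I : Fin (suc M) → Fin N → Bool) (c : Fin N) (c∈e₀ : T (I zero c)) (w : Weight) where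
    open FirstEdge I

    others-present : ∀ ℓ → noneOutside (selected others) (consL none ℓ) ≡ true
    others-present ℓ = T⇒≡true (all-allFin⁺ _ λ { zero → ∨-inr {memb zero (selected others)} tt
                                                 ; (suc j) → ∨-inl (memb-selected⁺ others (suc j) tt) })

    module _ (ℓ : Fin M → Lab) where
      open Labelled c c∈e₀ ℓ

      contracted-or-extracted : Carrier
      contracted-or-extracted =
        term (shiftSize w) (H ／ zero) (onOthers none) + when D meeting₀-none (term (shiftAll w) (H † zero) (onDisjoint none))

      e₀-deleted : term w H (with₀ none) ≈ term w (H ─ zero) (onOthers none)
      e₀-deleted = when-cong D vd-deletion (weight-cong w AsDeletion.kAB≡ AsDeletion.#AB≡ AsDeletion.kB≡)

      e₀-labelled-B-meets : T B-meets₀ → term w H (with₀ inA) + (term w H (with₀ inB) + 0#) ≈ contracted-or-extracted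
      e₀-labelled-B-meets B-meets = begin
        term w H (with₀ inA) + (term w H (with₀ inB) + 0#)   ≈⟨ +-cong (when-cong D (vd-A-blocked B-meets) ≈-refl) (+-identityʳ _) ⟩
        0# + term w H (with₀ inB)                            ≈⟨ +-identityˡ _ ⟩
        term w H (with₀ inB)
          ≈⟨ when-cong D (vd-B-contraction B-meets)
               (weight-cong w (AsContraction.kAB≡ inB tt) (AsContraction.#AB≡ inB tt) (SectionAsContractionB.kB≡ B-meets)) ⟩
        term (shiftSize w) (H ／ zero) (onOthers inB)         ≈⟨ term-extensional (shiftSize w) (H ／ zero) _ _ (onOthers-head inB none) ⟩
        term (shiftSize w) (H ／ zero) (onOthers none)        ≈⟨ ≈-sym (+-identityʳ _) ⟩
        term (shiftSize w) (H ／ zero) (onOthers none) + 0#   ≈⟨ +-cong ≈-refl (when-cong D (sym blocked) ≈-refl) ⟩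
        contracted-or-extracted                              ∎
        where
        B-not-none : ∀ x → T (isB x) → ¬ T (isNone x)
        B-not-none inB _ ()
        blocked : meeting₀-none ≡ false
        blocked with B-meets₀⁻ B-meets
        ... | j , bj , mt = ¬T⇒≡false λ h →
          ∨-elim (all-allFin⁻ (λ j → memb j (selected disjoint) ∨ isNone (with₀ none j)) h (suc j))
                 (λ mm → not-elim (∧-snd {true} (memb-selected⁻ disjoint (suc j) mm)) mt) (B-not-none (ℓ j) bj)

      e₀-labelled-B-apart : T (not B-meets₀) → term w H (with₀ inA) + (term w H (with₀ inB) + 0#) ≈ contracted-or-extracted
      e₀-labelled-B-apart ¬B-meets = begin
        term w H (with₀ inA) + (term w H (with₀ inB) + 0#)   ≈⟨ +-cong as-contraction (+-identityʳ _) ⟩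
        term (shiftSize w) (H ／ zero) (onOthers inA) + term w H (with₀ inB)
          ≈⟨ +-cong (term-extensional (shiftSize w) (H ／ zero) _ _ (onOthers-head inA none)) as-extraction ⟩
        term (shiftSize w) (H ／ zero) (onOthers none) + when D meeting₀-none (term (shiftAll w) (H † zero) (onDisjoint inB))
          ≈⟨ +-cong ≈-refl (when-congʳ D meeting₀-none (λ _ → term-extensional (shiftAll w) (H † zero) _ _ (onDisjoint-head inB none))) ⟩
        contracted-or-extracted                              ∎
        where
        as-contraction : term w H (with₀ inA) ≈ term (shiftSize w) (H ／ zero) (onOthers inA)
        as-contraction = when-cong D (vd-A-contraction ¬B-meets)
          (weight-cong w (AsContraction.kAB≡ inA tt) (AsContraction.#AB≡ inA tt) (SectionAsContractionA.kB≡ ¬B-meets))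
        as-extraction : term w H (with₀ inB) ≈ when D meeting₀-none (term (shiftAll w) (H † zero) (onDisjoint inB))
        as-extraction = begin
          when D (vertexDisjoint H (with₀ inB)) (weight w H (with₀ inB))
            ≈⟨ when-congʳ D (vertexDisjoint H (with₀ inB)) (λ vd → let open AsExtraction ¬B-meets (A-avoids-if-vd vd) in
                 weight-cong w kAB≡ #AB≡ kB≡) ⟩
          when D (vertexDisjoint H (with₀ inB)) (weight (shiftAll w) (H † zero) (onDisjoint inB))
            ≈⟨ when-cong D (vd-B-extraction ¬B-meets) ≈-refl ⟩
          when D (meeting₀-none ∧ vertexDisjoint (H † zero) (onDisjoint inB)) (weight (shiftAll w) (H † zero) (onDisjoint inB))
            ≈⟨ when-∧ D meeting₀-none _ _ ⟩
          when D meeting₀-none (term (shiftAll w) (H † zero) (onDisjoint inB)) ∎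

      by-label-of-e₀ : sumOver D labels (λ x → term w H (with₀ x)) ≈ term w (H ─ zero) (onOthers none) + contracted-or-extracted
      by-label-of-e₀ = +-cong e₀-deleted ([ e₀-labelled-B-meets , e₀-labelled-B-apart ]′ (T-dec B-meets₀))

    pairSum-recurrence : pairSum w H ≈ pairSum w (H ─ zero) + (pairSum (shiftSize w) (H ／ zero) + pairSum (shiftAll w) (H † zero))
    pairSum-recurrence = begin
      pairSum w H                                                       ≈⟨ sumOver-labelings-suc D M _ ⟩
      sumOver D (labelings M) (λ ℓ → sumOver D labels (λ x → term w H (consL x ℓ)))
                                                                        ≈⟨ sumOver-cong D (labelings M) by-label-of-e₀ ⟩
      sumOver D (labelings M) (λ ℓ → Del ℓ + (Con ℓ + Ext ℓ))           ≈⟨ ≈-trans (sumOver-+ D (labelings M) Del _)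
                                                                               (+-cong ≈-refl (sumOver-+ D (labelings M) Con Ext)) ⟩
      sumOver D (labelings M) Del + (sumOver D (labelings M) Con + sumOver D (labelings M) Ext)
        ≈⟨ +-cong (≈-sym (≈-trans (sumOver-select D others tt (term w (H ─ zero)) (term-extensional w (H ─ zero)))
                                  (sumOver-cong D (labelings M) (λ ℓ → when-cong D (others-present ℓ) ≈-refl))))
          (+-cong (≈-sym (≈-trans (sumOver-select D others tt (term (shiftSize w) (H ／ zero)) (term-extensional (shiftSize w) (H ／ zero)))
                                  (sumOver-cong D (labelings M) (λ ℓ → when-cong D (others-present ℓ) ≈-refl))))
                  (≈-sym (sumOver-select D disjoint tt (term (shiftAll w) (H † zero)) (term-extensional (shiftAll w) (H † zero))))) ⟩
      pairSum w (H ─ zero) + (pairSum (shiftSize w) (H ／ zero) + pairSum (shiftAll w) (H † zero)) ∎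
      where
      Del Con Ext : (Fin M → Lab) → Carrier
      Del ℓ = term w (H ─ zero) (consL none ℓ ∘ select others)
      Con ℓ = term (shiftSize w) (H ／ zero) (consL none ℓ ∘ select others)
      Ext ℓ = when D (noneOutside (selected disjoint) (consL none ℓ)) (term (shiftAll w) (H † zero) (consL none ℓ ∘ select disjoint))

first-edge-induction : ∀ {p} (P : Hypergraph → Set p) →
  (∀ N I → P (hg N 0 I)) →
  (∀ N M I → NonEmptyEdges (hg N (suc M) I) →
     P (hg N (suc M) I ─ zero) → P (hg N (suc M) I ／ zero) → P (hg N (suc M) I † zero) → P (hg N (suc M) I)) →
  ∀ H → NonEmptyEdges H → P H
first-edge-induction P edgeless split H = go (m H) H ≤-refl
  where
  go : ∀ fuel H → m H ≤ fuel → NonEmptyEdges H → P H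
  go fuel      (hg N zero I)    _         _  = edgeless N I
  go (suc fuel) (hg N (suc M) I) (s≤s le) ne = split N M I ne
    (go fuel _ (≤-trans deletion-size le) (deletion-nonEmpty ne))
    (go fuel _ (≤-trans contraction-size le) (contraction-nonEmpty ne))
    (go fuel _ (≤-trans extraction-size le) (extraction-nonEmpty ne))
    where open FirstEdge I

k-edgeless : ∀ G → m G ≡ 0 → k G ≡ n G
k-edgeless G no-edges = trans (count-cong _ (λ _ → true) (λ v → T⇒≡true (root v))) (count-true (n G))
  where
  trivial : ∀ {u v} → Connected G u v → u ≡ v
  trivial here = refl
  trivial (via j _ _ _ _) with () ← subst Fin no-edges j
  root : ∀ v → T (isRoot G v)
  root v = not-intro λ h → let (u , q) = any-allFin⁻ _ h in
    <-irrefl (cong toℕ (trivial (reach⇒Connected G u v (∧-snd {toℕ u <ᵇ toℕ v} q)))) (<ᵇ⇒< _ _ (∧-fst q))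

kB≤#AB : ∀ G (ℓ : Fin (m G) → Lab) → kB G ℓ ≤ #AB G ℓ
kB≤#AB G ℓ = ≤-trans (k-edgeSection≤ G (isB ∘ ℓ)) (count-mono (isB ∘ ℓ) (isAB ∘ ℓ) (λ j → B⇒AB (ℓ j)))
  where
  B⇒AB : ∀ a → T (isB a) → T (isAB a)
  B⇒AB inB _ = tt

module _ {c ℓ} (D : IntegralDomain c ℓ) where
  open Xi D hiding (zero) renaming (refl to ≈-refl; sym to ≈-sym; trans to ≈-trans)
  open import Relation.Binary.Reasoning.Setoid setoid
  open import Algebra.Solver.Ring.NaturalCoefficients.Default commutativeSemiring

  ξWeight : Carrier → (ℕ → Carrier) → Carrier → Weight D
  ξWeight x y z a b c = x ^ (a ∸ c) * y (b ∸ c) * z ^ c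

  xiGen≈pairSum : ∀ G x y z → xiGen G x y z ≈ pairSum D (ξWeight x y z) G
  xiGen≈pairSum G x y z = sumOver-filter D (vertexDisjoint G) (labelings (m G)) _

  pairSum-cong : ∀ G (w w' : Weight D) → (∀ ℓ → weight D w G ℓ ≈ weight D w' G ℓ) → pairSum D w G ≈ pairSum D w' G
  pairSum-cong G w w' e = sumOver-cong D (labelings (m G)) (λ ℓ → when-congʳ D (vertexDisjoint G ℓ) (λ _ → e ℓ))

  pairSum-* : ∀ G x (w : Weight D) → pairSum D (λ a b c → x * w a b c) G ≈ x * pairSum D w G
  pairSum-* G x w = ≈-trans (sumOver-cong D (labelings (m G)) (λ ℓ → when-* D (vertexDisjoint G ℓ) x (weight D w G ℓ)))
                            (sumOver-* D (labelings (m G)) x (term D w G))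

  pairSum-0 : ∀ G → pairSum D (λ _ _ _ → 0#) G ≈ 0#
  pairSum-0 G = ≈-trans (sumOver-cong D (labelings (m G)) (λ ℓ → when-0 D (vertexDisjoint G ℓ))) (sumOver-0 D (labelings (m G)))

  pairSum-edgeless : ∀ N (I : Fin 0 → Fin N → Bool) (w : Weight D) → pairSum D w (hg N 0 I) ≈ w N 0 0
  pairSum-edgeless N I w = ≈-trans (sumOver-cong D (labelings 0) edgeless-weight) (+-identityʳ _)
    where
    G = hg N 0 I
    edgeless-weight : ∀ ℓ → term D w G ℓ ≈ w N 0 0
    edgeless-weight ℓ = weight-cong D w (k-edgeless (partial G (isAB ∘ ℓ)) refl) refl
      (trans (k-edgeless (edgeSection G (isB ∘ ℓ)) refl) (count-false N))

  private
    factor-middle : ∀ X Y Z u → X * (u * Y) * Z ≈ u * (X * Y * Z)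
    factor-middle = solve 4 (λ X Y Z u → X :* (u :* Y) :* Z := u :* (X :* Y :* Z)) ≈-refl
    factor-last : ∀ X Y Z u → X * Y * (u * Z) ≈ u * (X * Y * Z)
    factor-last = solve 4 (λ X Y Z u → X :* Y :* (u :* Z) := u :* (X :* Y :* Z)) ≈-refl
    factor-middleʳ : ∀ X Y Y' Z u → X * (Y * (u * Y')) * Z ≈ u * (X * (Y * Y') * Z)
    factor-middleʳ = solve 5 (λ X Y Y' Z u → X :* (Y :* (u :* Y')) :* Z := u :* (X :* (Y :* Y') :* Z)) ≈-refl
    factor-middleˡ : ∀ X Y Y' Z u → X * ((u * Y) * Y') * Z ≈ u * (X * (Y * Y') * Z)
    factor-middleˡ = solve 5 (λ X Y Y' Z u → X :* ((u :* Y) :* Y') :* Z := u :* (X :* (Y :* Y') :* Z)) ≈-refl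

  module _ {N M : ℕ} (I : Fin (suc M) → Fin N → Bool) (c : Fin N) (c∈e₀ : T (I zero c)) where
    private
      H = hg N (suc M) I

    ξ-recurrence : ∀ x y z → ξ H x y z ≈ ξ (H ─ zero) x y z + (y * ξ (H ／ zero) x y z + z * ξ (H † zero) x y z)
    ξ-recurrence x y z = begin
      ξ H x y z                                                          ≈⟨ xiGen≈pairSum H x (y ^_) z ⟩
      pairSum D w H                                                      ≈⟨ Recurrence.pairSum-recurrence D I c c∈e₀ w ⟩
      pairSum D w (H ─ zero) + (pairSum D (shiftSize D w) (H ／ zero) + pairSum D (shiftAll D w) (H † zero))
        ≈⟨ +-cong (≈-sym (xiGen≈pairSum (H ─ zero) x (y ^_) z)) (+-cong contraction extraction) ⟩
      ξ (H ─ zero) x y z + (y * ξ (H ／ zero) x y z + z * ξ (H † zero) x y z) ∎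
      where
      w : Weight D
      w = ξWeight x (y ^_) z
      contraction : pairSum D (shiftSize D w) (H ／ zero) ≈ y * ξ (H ／ zero) x y z
      contraction = ≈-trans (pairSum-cong (H ／ zero) (shiftSize D w) (λ a b c → y * w a b c) one-more-y)
                      (≈-trans (pairSum-* (H ／ zero) y w) (*-cong ≈-refl (≈-sym (xiGen≈pairSum (H ／ zero) x (y ^_) z))))
        where
        one-more-y : ∀ ℓ → weight D (shiftSize D w) (H ／ zero) ℓ ≈ y * weight D w (H ／ zero) ℓ
        one-more-y ℓ = ≈-trans (reflexive (cong (λ e → x ^ (kAB (H ／ zero) ℓ ∸ kB (H ／ zero) ℓ) * y ^ e * z ^ kB (H ／ zero) ℓ)
                                                 (+-∸-assoc 1 (kB≤#AB (H ／ zero) ℓ))))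
                               (factor-middle _ _ _ y)
      extraction : pairSum D (shiftAll D w) (H † zero) ≈ z * ξ (H † zero) x y z
      extraction = ≈-trans (pairSum-cong (H † zero) (shiftAll D w) (λ a b c → z * w a b c) (λ ℓ → factor-last _ _ _ z))
                     (≈-trans (pairSum-* (H † zero) z w) (*-cong ≈-refl (≈-sym (xiGen≈pairSum (H † zero) x (y ^_) z))))

    βξ-recurrence : ∀ β x γ → βξ H β x γ 0# ≈ β * βξ (H ─ zero) β x γ 0# + (γ * βξ (H ／ zero) β x γ 0# + 0#)
    βξ-recurrence β x γ = begin
      βξ H β x γ 0#                                                      ≈⟨ xiGen≈pairSum H x βpow 0# ⟩
      pairSum D w H                                                      ≈⟨ Recurrence.pairSum-recurrence D I c c∈e₀ w ⟩
      pairSum D w (H ─ zero) + (pairSum D (shiftSize D w) (H ／ zero) + pairSum D (shiftAll D w) (H † zero))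
        ≈⟨ +-cong deletion (+-cong contraction (pairSum-vanishes)) ⟩
      β * βξ (H ─ zero) β x γ 0# + (γ * βξ (H ／ zero) β x γ 0# + 0#) ∎
      where
      open FirstEdge I using (others)
      βpow βpow' : ℕ → Carrier
      βpow  e = γ ^ e * β ^ (suc M ∸ e)
      βpow' e = γ ^ e * β ^ (count others ∸ e)
      w w' : Weight D
      w  = ξWeight x βpow 0#
      w' = ξWeight x βpow' 0#
      deletion : pairSum D w (H ─ zero) ≈ β * βξ (H ─ zero) β x γ 0#
      deletion = ≈-trans (pairSum-cong (H ─ zero) w (λ a b c → β * w' a b c) one-more-β)
                   (≈-trans (pairSum-* (H ─ zero) β w') (*-cong ≈-refl (≈-sym (xiGen≈pairSum (H ─ zero) x βpow' 0#))))
        where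
        one-more-β : ∀ ℓ → weight D w (H ─ zero) ℓ ≈ β * weight D w' (H ─ zero) ℓ
        one-more-β ℓ = ≈-trans (reflexive (cong (λ u → x ^ (kAB (H ─ zero) ℓ ∸ kB (H ─ zero) ℓ) * (γ ^ e * β ^ u) * 0# ^ kB (H ─ zero) ℓ)
                                                 (trans (cong (λ M' → suc M' ∸ e) (sym (count-nonzero M))) (+-∸-assoc 1 e≤))))
                               (factor-middleʳ _ _ _ _ β)
          where
          e = #AB (H ─ zero) ℓ ∸ kB (H ─ zero) ℓ
          e≤ : e ≤ count others
          e≤ = ≤-trans (m∸n≤m (#AB (H ─ zero) ℓ) (kB (H ─ zero) ℓ)) (count≤size (isAB ∘ ℓ))
      contraction : pairSum D (shiftSize D w) (H ／ zero) ≈ γ * βξ (H ／ zero) β x γ 0#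
      contraction = ≈-trans (pairSum-cong (H ／ zero) (shiftSize D w) (λ a b c → γ * w' a b c) one-more-γ)
                      (≈-trans (pairSum-* (H ／ zero) γ w') (*-cong ≈-refl (≈-sym (xiGen≈pairSum (H ／ zero) x βpow' 0#))))
        where
        one-more-γ : ∀ ℓ → weight D (shiftSize D w) (H ／ zero) ℓ ≈ γ * weight D w' (H ／ zero) ℓ
        one-more-γ ℓ = ≈-trans (reflexive (trans
                                 (cong (λ u → x ^ (kA ∸ kb) * (γ ^ u * β ^ (suc M ∸ u)) * 0# ^ kb) (+-∸-assoc 1 (kB≤#AB (H ／ zero) ℓ)))
                                 (cong (λ M' → x ^ (kA ∸ kb) * (γ ^ suc (nAB ∸ kb) * β ^ (M' ∸ (nAB ∸ kb))) * 0# ^ kb) (sym (count-nonzero M)))))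
                               (factor-middleˡ _ _ _ _ γ)
          where
          kA = kAB (H ／ zero) ℓ
          nAB = #AB (H ／ zero) ℓ
          kb = kB (H ／ zero) ℓ
      pairSum-vanishes : pairSum D (shiftAll D w) (H † zero) ≈ 0#
      pairSum-vanishes = ≈-trans (pairSum-cong (H † zero) (shiftAll D w) (λ _ _ _ → 0#) (λ ℓ → ≈-trans (*-cong ≈-refl (zeroˡ _)) (zeroʳ _)))
                                 (pairSum-0 (H † zero))

first-edge-vertex : ∀ {N M} (I : Fin (suc M) → Fin N → Bool) → NonEmptyEdges (hg N (suc M) I) → Σ (Fin N) λ c → T (I zero c)
first-edge-vertex I ne = proj₁ (ne zero) , ≡true⇒T (proj₂ (ne zero))

no-edges-nonEmpty : ∀ N (I : Fin 0 → Fin N → Bool) → NonEmptyEdges (hg N 0 I)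
no-edges-nonEmpty N I ()

-- G₁ has the edges {0} and {0, 1} on the vertices 0 and 1; G₂ has the edges
-- {0}, {1} and {0, 1}. K₁, K₂, K₃ arise from G₂ by deleting or contracting
-- its first or its last edge.
G₁ G₂ K₁ K₂ K₃ : Hypergraph
G₁ = hg 2 2 edges
  where
  edges : Fin 2 → Fin 2 → Bool
  edges zero    v = v =ᶠ zero
  edges (suc _) _ = true
G₂ = hg 2 3 edges
  where
  edges : Fin 3 → Fin 2 → Bool
  edges zero             v = v =ᶠ zero
  edges (suc zero)       v = v =ᶠ suc zero
  edges (suc (suc zero)) _ = true
K₁ = hg 2 2 edges
  where
  edges : Fin 2 → Fin 2 → Bool
  edges zero    v = v =ᶠ suc zero
  edges (suc _) _ = true
K₂ = hg 2 2 _=ᶠ_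
K₃ = hg 1 2 (λ _ _ → true)

G₁-ne : NonEmptyEdges G₁
G₁-ne zero       = zero , refl
G₁-ne (suc zero) = zero , refl

G₁─e₁-ne : NonEmptyEdges (G₁ ─ suc zero)
G₁─e₁-ne zero = zero , refl

G₁／e₁-ne : NonEmptyEdges (G₁ ／ suc zero)
G₁／e₁-ne zero = zero , refl

G₁†e₁-ne : NonEmptyEdges (G₁ † suc zero)
G₁†e₁-ne ()

G₂-ne : NonEmptyEdges G₂
G₂-ne zero             = zero , refl
G₂-ne (suc zero)       = suc zero , refl
G₂-ne (suc (suc zero)) = zero , refl

G₂─e₂-ne : NonEmptyEdges (G₂ ─ suc (suc zero))
G₂─e₂-ne zero       = zero , refl
G₂─e₂-ne (suc zero) = suc zero , refl

G₂／e₂-ne : NonEmptyEdges (G₂ ／ suc (suc zero))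
G₂／e₂-ne zero       = zero , refl
G₂／e₂-ne (suc zero) = zero , refl

G₂†e₂-ne : NonEmptyEdges (G₂ † suc (suc zero))
G₂†e₂-ne ()

K₁-ne : NonEmptyEdges K₁
K₁-ne zero       = suc zero , refl
K₁-ne (suc zero) = zero , refl

K₂-ne : NonEmptyEdges K₂
K₂-ne zero       = zero , refl
K₂-ne (suc zero) = suc zero , refl

K₃-ne : NonEmptyEdges K₃
K₃-ne _ = zero , refl

same-incidence : ∀ {N M} {I I' : Fin M → Fin N → Bool} → (∀ j v → I' j v ≡ I j v) → hg N M I ≅ hg N M I'
same-incidence p = record { vbij = ↔-id _ ; ebij = ↔-id _ ; pres = p }

G₂─e₀≅K₁ : (G₂ ─ zero) ≅ K₁
G₂─e₀≅K₁ = same-incidence λ { zero zero → refl ; zero (suc zero) → refl ; (suc zero) zero → refl ; (suc zero) (suc zero) → refl }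

G₂／e₀≅K₁ : (G₂ ／ zero) ≅ K₁
G₂／e₀≅K₁ = same-incidence λ { zero zero → refl ; zero (suc zero) → refl ; (suc zero) zero → refl ; (suc zero) (suc zero) → refl }

G₂─e₂≅K₂ : (G₂ ─ suc (suc zero)) ≅ K₂
G₂─e₂≅K₂ = same-incidence λ { zero zero → refl ; zero (suc zero) → refl ; (suc zero) zero → refl ; (suc zero) (suc zero) → refl }

G₂／e₂≅K₃ : (G₂ ／ suc (suc zero)) ≅ K₃
G₂／e₂≅K₃ = same-incidence λ { zero zero → refl ; (suc zero) zero → refl }

module _ {c ℓ} (D : IntegralDomain c ℓ) where
  open Xi D hiding (zero) renaming (refl to ≈-refl; sym to ≈-sym; trans to ≈-trans)
  open import Relation.Binary.Reasoning.Setoid setoid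
  open import Algebra.Solver.Ring.NaturalCoefficients.Default commutativeSemiring
  open import Algebra.Properties.Group +-group using (∙-cancelˡ; ∙-cancelʳ; x∙y⁻¹≈ε⇒x≈y)
  open import Algebra.Properties.Ring ring using (-1*x≈-x; -‿involutive)

  x-1≈0⇒x≈1 : ∀ x → x - 1# ≈ 0# → x ≈ 1#
  x-1≈0⇒x≈1 x = x∙y⁻¹≈ε⇒x≈y x 1#

  ^≈1 : ∀ {x} → x ≈ 1# → ∀ N → x ^ N ≈ 1#
  ^≈1 x≈1 zero    = ≈-refl
  ^≈1 x≈1 (suc N) = ≈-trans (*-cong x≈1 (^≈1 x≈1 N)) (*-identityˡ 1#)

  factor-vanishes : ∀ z x y → z * x * y + z ≈ z * x + z * y → z * ((x - 1#) * (y - 1#)) ≈ 0#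
  factor-vanishes z x y h = ∙-cancelʳ (z * x + z * y) _ 0# (begin
    z * ((x - 1#) * (y - 1#)) + (z * x + z * y)
      ≈⟨ expand z x y (- 1#) ⟩
    z * x * y + z * x * (- 1# + 1#) + z * y * (- 1# + 1#) + z * (- 1# * - 1#)
      ≈⟨ +-cong (+-cong (+-cong ≈-refl (cancels (z * x))) (cancels (z * y)))
                (≈-trans (*-cong ≈-refl (≈-trans (-1*x≈-x (- 1#)) (-‿involutive 1#))) (*-identityʳ z)) ⟩
    z * x * y + 0# + 0# + z                ≈⟨ +-cong (≈-trans (+-identityʳ _) (+-identityʳ _)) ≈-refl ⟩
    z * x * y + z                          ≈⟨ h ⟩
    z * x + z * y                          ≈⟨ ≈-sym (+-identityˡ _) ⟩
    0# + (z * x + z * y)                   ∎)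
    where
    expand : ∀ z x y u → z * ((x + u) * (y + u)) + (z * x + z * y) ≈
                         z * x * y + z * x * (u + 1#) + z * y * (u + 1#) + z * (u * u)
    expand = solve 4 (λ z x y u → z :* ((x :+ u) :* (y :+ u)) :+ (z :* x :+ z :* y) :=
                                  z :* x :* y :+ z :* x :* (u :+ x :^ 0) :+ z :* y :* (u :+ x :^ 0) :+ z :* (u :* u)) ≈-refl
    cancels : ∀ a → a * (- 1# + 1#) ≈ 0#
    cancels a = ≈-trans (*-cong ≈-refl (-‿inverseˡ 1#)) (zeroʳ a)

  ξ-trivial : ∀ α H → NonEmptyEdges H → ξ H α 0# 0# ≈ α ^ n H
  ξ-trivial α = first-edge-induction (λ H → ξ H α 0# 0# ≈ α ^ n H)
    (λ N I → ≈-trans (xiGen≈pairSum D (hg N 0 I) α (0# ^_) 0#)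
               (≈-trans (pairSum-edgeless D N I (ξWeight D α (0# ^_) 0#)) (≈-trans (*-identityʳ _) (*-identityʳ _))))
    (λ N M I ne ih─ _ _ → let (c , c∈e₀) = first-edge-vertex I ne in
       ≈-trans (ξ-recurrence D I c c∈e₀ α 0# 0#)
         (≈-trans (+-cong ≈-refl (≈-trans (+-cong (zeroˡ _) (zeroˡ _)) (+-identityˡ _))) (≈-trans (+-identityʳ _) ih─)))

  module Classification (α β γ δ : Carrier) (f : Hypergraph → Carrier)
    (iso : ∀ H H' → NonEmptyEdges H → NonEmptyEdges H' → H ≅ H' → f H ≈ f H')
    (f₀ : f E₀ ≈ 1#) (f₁ : f E₁ ≈ α)
    (mult : ∀ H₁ H₂ → NonEmptyEdges H₁ → NonEmptyEdges H₂ → f (H₁ ⊕ H₂) ≈ f H₁ * f H₂)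
    (rec : ∀ H → NonEmptyEdges H → (i : Fin (m H)) → f H ≈ β * f (H ─ i) + γ * f (H ／ i) + δ * f (H † i)) where

    f-edgeless : ∀ N (I : Fin 0 → Fin N → Bool) → f (hg N 0 I) ≈ α ^ N
    f-edgeless zero I = ≈-trans (iso _ _ (no-edges-nonEmpty 0 I) (λ ()) identical) f₀
      where
      identical : hg 0 0 I ≅ E₀
      identical = record { vbij = ↔-id _ ; ebij = ↔-id _ ; pres = λ () }
    f-edgeless (suc N) I = begin
      f (hg (suc N) 0 I)            ≈⟨ iso _ _ (no-edges-nonEmpty (suc N) I) (λ ()) split ⟩
      f (E₁ ⊕ hg N 0 (λ ()))        ≈⟨ mult _ _ (λ ()) (λ ()) ⟩
      f E₁ * f (hg N 0 (λ ()))      ≈⟨ *-cong f₁ (f-edgeless N _) ⟩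
      α * α ^ N                     ∎
      where
      split : hg (suc N) 0 I ≅ (E₁ ⊕ hg N 0 (λ ()))
      split = record { vbij = ↔-id _ ; ebij = ↔-id _ ; pres = λ () }

    agrees-with : ∀ (Φ : Hypergraph → Carrier) → (∀ N I → Φ (hg N 0 I) ≈ α ^ N) →
      (∀ N M I → NonEmptyEdges (hg N (suc M) I) →
         Φ (hg N (suc M) I) ≈ β * Φ (hg N (suc M) I ─ zero) + γ * Φ (hg N (suc M) I ／ zero) + δ * Φ (hg N (suc M) I † zero)) →
      ∀ H → NonEmptyEdges H → f H ≈ Φ H
    agrees-with Φ edgeless split = first-edge-induction (λ H → f H ≈ Φ H)
      (λ N I → ≈-trans (f-edgeless N I) (≈-sym (edgeless N I)))
      (λ N M I ne ih─ ih／ ih† → ≈-trans (rec _ ne zero)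
         (≈-trans (+-cong (+-cong (*-cong ≈-refl ih─) (*-cong ≈-refl ih／)) (*-cong ≈-refl ih†)) (≈-sym (split N M I ne))))

    solution-δ≈0 : δ ≈ 0# → ∀ H → NonEmptyEdges H → f H ≈ βξ H β α γ 0#
    solution-δ≈0 δ≈0 = agrees-with (λ H → βξ H β α γ 0#) edgeless split
      where
      βpow : ℕ → Carrier
      βpow e = γ ^ e * β ^ (0 ∸ e)
      edgeless : ∀ N I → βξ (hg N 0 I) β α γ 0# ≈ α ^ N
      edgeless N I = ≈-trans (xiGen≈pairSum D (hg N 0 I) α βpow 0#) (≈-trans (pairSum-edgeless D N I (ξWeight D α βpow 0#))
                       (≈-trans (*-identityʳ _) (≈-trans (*-cong ≈-refl (*-identityˡ 1#)) (*-identityʳ _))))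
      split : ∀ N M I → NonEmptyEdges (hg N (suc M) I) → _
      split N M I ne with first-edge-vertex I ne
      ... | c , c∈e₀ = ≈-trans (βξ-recurrence D I c c∈e₀ β α γ)
                         (≈-trans (≈-sym (+-assoc _ _ _)) (+-cong ≈-refl (≈-sym (≈-trans (*-cong δ≈0 ≈-refl) (zeroˡ _)))))

    solution-β≈1 : β ≈ 1# → ∀ H → NonEmptyEdges H → f H ≈ ξ H α γ δ
    solution-β≈1 β≈1 = agrees-with (λ H → ξ H α γ δ) edgeless split
      where
      edgeless : ∀ N I → ξ (hg N 0 I) α γ δ ≈ α ^ N
      edgeless N I = ≈-trans (xiGen≈pairSum D (hg N 0 I) α (γ ^_) δ)
                       (≈-trans (pairSum-edgeless D N I (ξWeight D α (γ ^_) δ)) (≈-trans (*-identityʳ _) (*-identityʳ _)))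
      split : ∀ N M I → NonEmptyEdges (hg N (suc M) I) → _
      split N M I ne with first-edge-vertex I ne
      ... | c , c∈e₀ = ≈-trans (ξ-recurrence D I c c∈e₀ α γ δ)
                         (≈-trans (≈-sym (+-assoc _ _ _)) (+-cong (+-cong (≈-sym (≈-trans (*-cong β≈1 ≈-refl) (*-identityˡ _))) ≈-refl) ≈-refl))

    solution-trivial : α ≈ 1# → β + γ + δ ≈ 1# → ∀ H → NonEmptyEdges H → f H ≈ α ^ n H × f H ≈ ξ H α 0# 0#
    solution-trivial α≈1 sum≈1 H ne = f≈α^n , ≈-trans f≈α^n (≈-sym (ξ-trivial α H ne))
      where
      f≈α^n : f H ≈ α ^ n H
      f≈α^n = agrees-with (λ H → α ^ n H) (λ N I → ≈-refl)
        (λ N M I ne → ≈-trans (^≈1 α≈1 N) (≈-sym (≈-trans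
           (+-cong (+-cong (≈-trans (*-cong ≈-refl (^≈1 α≈1 N)) (*-identityʳ β))
                           (≈-trans (*-cong ≈-refl (^≈1 α≈1 (n (hg N (suc M) I ／ zero)))) (*-identityʳ γ)))
                   (≈-trans (*-cong ≈-refl (^≈1 α≈1 (n (hg N (suc M) I † zero)))) (*-identityʳ δ))) sum≈1))) H ne

    -- The recurrence applied at the first edge down to edgeless hypergraphs,
    -- valued by base; fuel bounds the number of edges (0# is a junk value).
    forced : (ℕ → Carrier) → ℕ → Hypergraph → Carrier
    forced base _          (hg N zero I)    = base N
    forced base zero       (hg N (suc M) I) = 0#
    forced base (suc fuel) (hg N (suc M) I) =
      β * forced base fuel (H ─ zero) + γ * forced base fuel (H ／ zero) + δ * forced base fuel (H † zero)
      where H = hg N (suc M) I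

    forced-correct : ∀ (base : ℕ → Carrier) → (∀ N → α ^ N ≈ base N) →
      ∀ H → NonEmptyEdges H → ∀ fuel → m H ≤ fuel → f H ≈ forced base fuel H
    forced-correct base α^≈base = first-edge-induction (λ H → ∀ fuel → m H ≤ fuel → f H ≈ forced base fuel H)
      (λ N I _ _ → ≈-trans (f-edgeless N I) (α^≈base N))
      (λ { N M I ne ih─ ih／ ih† (suc fuel) (s≤s le) → let open FirstEdge I in ≈-trans (rec _ ne zero)
         (+-cong (+-cong (*-cong ≈-refl (ih─ fuel (≤-trans deletion-size le))) (*-cong ≈-refl (ih／ fuel (≤-trans contraction-size le))))
                 (*-cong ≈-refl (ih† fuel (≤-trans extraction-size le)))) })

    -- Expanding f G₁ at its first and at its second edge.
    G₁-expansions : β * (β * α ^ 2 + γ * α ^ 1 + δ * α ^ 0) + γ * (β * α ^ 2 + γ * α ^ 1 + δ * α ^ 0) + δ * α ^ 1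
                  ≈ β * (β * α ^ 2 + γ * α ^ 2 + δ * α ^ 1) + γ * (β * α ^ 1 + γ * α ^ 1 + δ * α ^ 0) + δ * α ^ 0
    G₁-expansions = ≈-trans (≈-sym (forced-α G₁ G₁-ne 2 ≤-refl)) (≈-trans (rec G₁ G₁-ne (suc zero))
      (+-cong (+-cong (*-cong ≈-refl (forced-α _ G₁─e₁-ne 1 ≤-refl)) (*-cong ≈-refl (forced-α _ G₁／e₁-ne 1 ≤-refl)))
              (*-cong ≈-refl (forced-α _ G₁†e₁-ne 1 z≤n))))
      where
      forced-α : ∀ H → NonEmptyEdges H → ∀ fuel → m H ≤ fuel → f H ≈ forced (α ^_) fuel H
      forced-α = forced-correct (α ^_) (λ _ → ≈-refl)

    constraint₁ : δ * ((α - 1#) * (β - 1#)) ≈ 0#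
    constraint₁ = factor-vanishes δ α β (∙-cancelˡ _ _ _ (≈-trans (+-cong (≈-sym G₁-expansions) ≈-refl) (identity α β γ δ)))
      where
      identity : ∀ a b g d →
        b * (b * a ^ 2 + g * a ^ 1 + d * a ^ 0) + g * (b * a ^ 2 + g * a ^ 1 + d * a ^ 0) + d * a ^ 1 + (d * a * b + d) ≈
        b * (b * a ^ 2 + g * a ^ 2 + d * a ^ 1) + g * (b * a ^ 1 + g * a ^ 1 + d * a ^ 0) + d * a ^ 0 + (d * a + d * b)
      identity = solve 4 (λ a b g d →
        b :* (b :* a :^ 2 :+ g :* a :^ 1 :+ d :* a :^ 0) :+ g :* (b :* a :^ 2 :+ g :* a :^ 1 :+ d :* a :^ 0) :+ d :* a :^ 1 :+ (d :* a :* b :+ d) :=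
        b :* (b :* a :^ 2 :+ g :* a :^ 2 :+ d :* a :^ 1) :+ g :* (b :* a :^ 1 :+ g :* a :^ 1 :+ d :* a :^ 0) :+ d :* a :^ 0 :+ (d :* a :+ d :* b)) ≈-refl

    module _ (α≈1 : α ≈ 1#) where
      private
        s₁ : Carrier
        s₁ = β * 1# + γ * 1# + δ * 1#

        forced-1 : ∀ H → NonEmptyEdges H → ∀ fuel → m H ≤ fuel → f H ≈ forced (λ _ → 1#) fuel H
        forced-1 = forced-correct (λ _ → 1#) (^≈1 α≈1)

        forced-iso : ∀ {H K} → NonEmptyEdges H → NonEmptyEdges K → H ≅ K → ∀ fuel → m K ≤ fuel →
                     f H ≈ forced (λ _ → 1#) fuel K
        forced-iso neH neK H≅K fuel le = ≈-trans (iso _ _ neH neK H≅K) (forced-1 _ neK fuel le)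

      -- Expanding f G₂ at its first and at its last edge.
      G₂-expansions : β * (β * s₁ + γ * s₁ + δ * 1#) + γ * (β * s₁ + γ * s₁ + δ * 1#) + δ * s₁
                    ≈ β * (β * s₁ + γ * s₁ + δ * s₁) + γ * (β * s₁ + γ * s₁ + δ * 1#) + δ * 1#
      G₂-expansions = begin
        β * (β * s₁ + γ * s₁ + δ * 1#) + γ * (β * s₁ + γ * s₁ + δ * 1#) + δ * s₁
          ≈⟨ ≈-sym (+-cong (+-cong (*-cong ≈-refl (forced-iso (deletion-nonEmpty G₂-ne) K₁-ne G₂─e₀≅K₁ 2 ≤-refl))
                                   (*-cong ≈-refl (forced-iso (contraction-nonEmpty G₂-ne) K₁-ne G₂／e₀≅K₁ 2 ≤-refl)))
                           (*-cong ≈-refl (forced-1 _ (extraction-nonEmpty G₂-ne) 1 ≤-refl))) ⟩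
        β * f (G₂ ─ zero) + γ * f (G₂ ／ zero) + δ * f (G₂ † zero)
          ≈⟨ ≈-sym (rec G₂ G₂-ne zero) ⟩
        f G₂
          ≈⟨ rec G₂ G₂-ne (suc (suc zero)) ⟩
        β * f (G₂ ─ suc (suc zero)) + γ * f (G₂ ／ suc (suc zero)) + δ * f (G₂ † suc (suc zero))
          ≈⟨ +-cong (+-cong (*-cong ≈-refl (forced-iso G₂─e₂-ne K₂-ne G₂─e₂≅K₂ 2 ≤-refl))
                            (*-cong ≈-refl (forced-iso G₂／e₂-ne K₃-ne G₂／e₂≅K₃ 2 ≤-refl)))
                    (*-cong ≈-refl (forced-1 _ G₂†e₂-ne 0 z≤n)) ⟩
        β * (β * s₁ + γ * s₁ + δ * s₁) + γ * (β * s₁ + γ * s₁ + δ * 1#) + δ * 1# ∎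
        where open FirstEdge (inc G₂)

      constraint₂ : δ * ((β - 1#) * ((β + γ + δ) - 1#)) ≈ 0#
      constraint₂ = factor-vanishes δ β (β + γ + δ)
        (∙-cancelˡ _ _ _ (≈-trans (+-cong (≈-sym G₂-expansions) ≈-refl) (identity β γ δ)))
        where
        identity : ∀ b g d → let s₁ = b * 1# + g * 1# + d * 1# in
          b * (b * s₁ + g * s₁ + d * 1#) + g * (b * s₁ + g * s₁ + d * 1#) + d * s₁ + (d * b * (b + g + d) + d) ≈
          b * (b * s₁ + g * s₁ + d * s₁) + g * (b * s₁ + g * s₁ + d * 1#) + d * 1# + (d * b + d * (b + g + d))
        identity = solve 3 (λ b g d → let one = b :^ 0; s₁ = b :* one :+ g :* one :+ d :* one in
          b :* (b :* s₁ :+ g :* s₁ :+ d :* one) :+ g :* (b :* s₁ :+ g :* s₁ :+ d :* one) :+ d :* s₁ :+ (d :* b :* (b :+ g :+ d) :+ d) :=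
          b :* (b :* s₁ :+ g :* s₁ :+ d :* s₁) :+ g :* (b :* s₁ :+ g :* s₁ :+ d :* one) :+ d :* one :+ (d :* b :+ d :* (b :+ g :+ d))) ≈-refl

    Conclusion : Set _
    Conclusion = (δ ≈ 0# × (∀ H → NonEmptyEdges H → f H ≈ βξ H β α γ 0#))
               ⊎ (β ≈ 1# × (∀ H → NonEmptyEdges H → f H ≈ ξ H α γ δ))
               ⊎ (∀ H → NonEmptyEdges H → f H ≈ α ^ n H × f H ≈ ξ H α 0# 0#)

    conclusion-δ≈0 : δ ≈ 0# → Conclusion
    conclusion-δ≈0 δ≈0 = inj₁ (δ≈0 , solution-δ≈0 δ≈0)

    conclusion-β≈1 : β - 1# ≈ 0# → Conclusion
    conclusion-β≈1 h = inj₂ (inj₁ (x-1≈0⇒x≈1 β h , solution-β≈1 (x-1≈0⇒x≈1 β h)))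

    conclusion-trivial : α ≈ 1# → (β + γ + δ) - 1# ≈ 0# → Conclusion
    conclusion-trivial α≈1 h = inj₂ (inj₂ (solution-trivial α≈1 (x-1≈0⇒x≈1 (β + γ + δ) h)))

mainTheorem10 : ∀ {c ℓ} (D : IntegralDomain c ℓ) → let open Xi D in
    (α β γ δ : Carrier) (f : Hypergraph → Carrier) →
    (∀ H H' → NonEmptyEdges H → NonEmptyEdges H' → H ≅ H' → f H ≈ f H') →
    f E₀ ≈ 1# →
    f E₁ ≈ α →
    (∀ H₁ H₂ → NonEmptyEdges H₁ → NonEmptyEdges H₂ → f (H₁ ⊕ H₂) ≈ f H₁ * f H₂) →
    (∀ H → NonEmptyEdges H → (i : Fin (m H)) →
      f H ≈ β * f (H ─ i) + γ * f (H ／ i) + δ * f (H † i)) →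
    (δ ≈ 0# × (∀ H → NonEmptyEdges H → f H ≈ βξ H β α γ 0#))
    ⊎ (β ≈ 1# × (∀ H → NonEmptyEdges H → f H ≈ ξ H α γ δ))
    ⊎ (∀ H → NonEmptyEdges H → f H ≈ α ^ n H × f H ≈ ξ H α 0# 0#)
mainTheorem10 D α β γ δ f iso f₀ f₁ mult rec =
  by-δ (noZeroDivisors δ ((α - 1#) * (β - 1#)) constraint₁)
  where
  open Xi D hiding (zero)
  open Classification D α β γ δ f iso f₀ f₁ mult rec

  by-β-or-sum : α ≈ 1# → β - 1# ≈ 0# ⊎ (β + γ + δ) - 1# ≈ 0# → Conclusion
  by-β-or-sum α≈1 (inj₁ h) = conclusion-β≈1 h
  by-β-or-sum α≈1 (inj₂ h) = conclusion-trivial α≈1 h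

  by-δ-when-α≈1 : α ≈ 1# → δ ≈ 0# ⊎ (β - 1#) * ((β + γ + δ) - 1#) ≈ 0# → Conclusion
  by-δ-when-α≈1 α≈1 (inj₁ δ≈0) = conclusion-δ≈0 δ≈0
  by-δ-when-α≈1 α≈1 (inj₂ q)   = by-β-or-sum α≈1 (noZeroDivisors (β - 1#) ((β + γ + δ) - 1#) q)

  by-α-or-β : α - 1# ≈ 0# ⊎ β - 1# ≈ 0# → Conclusion
  by-α-or-β (inj₁ h) = by-δ-when-α≈1 α≈1 (noZeroDivisors δ ((β - 1#) * ((β + γ + δ) - 1#)) (constraint₂ α≈1))
    where α≈1 = x-1≈0⇒x≈1 D α h
  by-α-or-β (inj₂ h) = conclusion-β≈1 h

  by-δ : δ ≈ 0# ⊎ (α - 1#) * (β - 1#) ≈ 0# → Conclusion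
  by-δ (inj₁ δ≈0) = conclusion-δ≈0 δ≈0
  by-δ (inj₂ p)   = by-α-or-β (noZeroDivisors (α - 1#) (β - 1#) p)
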